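{- Let $m=2^\ell p_1^{a_1}\cdots p_k^{a_k}$ be the prime factorization of a positive integer $m$ (with $p_1,\dots,p_k$ distinct odd primes, $a_j\geq1$, $\ell\geq0$), and let $m_0=\prod_{j:\,a_j\text{ odd}}p_j$ be the squarefree part of $p_1^{a_1}\cdots p_k^{a_k}$. Then $$ \frac{1}{m}\sum_{n=1}^{m}\left(\frac{4n^{2}+1}{m}\right)= \begin{cases} \displaystyle \frac{1}{m_0}(-1)^{\omega(m_0)}\prod_{\substack{1\leq j\leq k\\2\mid a_j}}\left(1-\frac{c(p_j)}{p_j}\right) & \text{ if } \ell \text{ is even},\\ 0 & \text{ if } \ell \text{ is odd}. \end{cases} $$
   Context: $\left(\frac{a}{m}\right)$ denotes the Kronecker symbol, $\omega(n)$ is the number of distinct prime factors of $n$, and for a prime $p$, $c(p)=1+\left(\frac{ -1}{p}\right)$. -}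

module Defs where

open import Data.Nat as ℕ using (ℕ; zero; suc; _≤?_)
open import Data.Nat.Divisibility using (_∣?_)
open import Data.Nat.Primality using (prime?)
open import Data.Integer as ℤ using (ℤ; +_; -[1+_])
open import Data.Integer.DivMod using (_%ℕ_)
open import Data.Rational as ℚ using (ℚ)
open import Data.Fin using (Fin; zero; suc)
open import Data.List using (List; []; _∷_; upTo; filter; length)
open import Data.Bool.ListAction using (any)
open import Data.Bool using (Bool; true; false; if_then_else_)
open import Relation.Nullary.Decidable using (⌊_⌋; _×-dec_)
open import Data.Nat using (_≡ᵇ_)

prodℕ : (k : ℕ) → (Fin k → ℕ) → ℕ
prodℕ zero f = 1
prodℕ (suc k) f = f zero ℕ.* prodℕ k (λ j → f (suc j))

prodℚ : (k : ℕ) → (Fin k → ℚ) → ℚ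
prodℚ zero f = ℚ.1ℚ
prodℚ (suc k) f = f zero ℚ.* prodℚ k (λ j → f (suc j))

sumFrom1 : ℕ → (ℕ → ℤ) → ℤ
sumFrom1 zero f = + 0
sumFrom1 (suc m) f = sumFrom1 m f ℤ.+ f (suc m)

-- embedding ℤ → ℚ and reciprocal of a natural number (1/0 := 0, never used)
toℚ : ℤ → ℚ
toℚ z = z ℚ./ 1

inv : ℕ → ℚ
inv zero = ℚ.0ℚ
inv (suc n) = + 1 ℚ./ suc n

-- Kronecker symbol (a/p) for a prime p.
-- p = 2: 0 if a even, 1 if a ≡ ±1 (mod 8), -1 if a ≡ ±3 (mod 8).
-- p odd: Legendre symbol: 0 if p ∣ a, 1 if a is a nonzero square mod p, -1 otherwise.
symP : ℤ → ℕ → ℤ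
symP a zero = + 0
symP a (suc q) with (suc q) ≡ᵇ 2
... | true with a %ℕ 8
...   | 1 = + 1
...   | 7 = + 1
...   | 3 = -[1+ 0 ]
...   | 5 = -[1+ 0 ]
...   | _ = + 0
symP a (suc q) | false =
  if (a %ℕ suc q) ≡ᵇ 0 then + 0
  else if any (λ x → ((+ (x ℕ.* x) ℤ.- a) %ℕ suc q) ≡ᵇ 0) (upTo (suc q)) then + 1
  else -[1+ 0 ]

minDivFrom : ℕ → ℕ → ℕ → ℕ
minDivFrom zero d m = m
minDivFrom (suc fuel) d m = if ⌊ d ∣? m ⌋ then d else minDivFrom fuel (suc d) m

spf : ℕ → ℕ
spf m = minDivFrom m 2 m

-- Kronecker symbol (a/m) for m ≥ 1, by complete multiplicativity in m:
-- (a/m) = (a/p)·(a/(m/p)) with p the least prime factor of m; (a/1) = 1.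
-- m / d (with the convention m / 0 = m; only used with d ≥ 2)
divBy : ℕ → ℕ → ℕ
divBy m zero = m
divBy m (suc d) = m ℕ./ suc d

kronF : ℕ → ℤ → ℕ → ℤ
kronF zero a m = + 1
kronF (suc fuel) a zero = + 1
kronF (suc fuel) a (suc zero) = + 1
kronF (suc fuel) a (suc (suc m)) =
  symP a (spf (suc (suc m))) ℤ.* kronF fuel a (divBy (suc (suc m)) (spf (suc (suc m))))

kronecker : ℤ → ℕ → ℤ
kronecker a m = kronF m a m

ω : ℕ → ℕ
ω n = length (filter (λ q → prime? q ×-dec q ∣? n) (upTo (suc n)))

c : ℕ → ℤ
c p = + 1 ℤ.+ kronecker -[1+ 0 ] p

-- The summand n ↦ (4n²+1 / m) is periodic modulo m and, the Kronecker symbol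
-- being completely multiplicative in its lower argument, it is the product of the characters
-- n ↦ (4n²+1 / q)^e over the prime powers q^e ∥ m, each periodic modulo q^e. By the Chinese remainder
-- theorem the sum over a period is therefore the product of the local sums.
-- At q = 2 the symbol is 1 for even n and −1 for odd n, so the local sum is 2^ℓ or 0 as ℓ is even or odd.
-- At an odd prime p, (b / p) is the number of square roots of b modulo p minus one. As n ↦ 2n permutes
-- ℤ/p, the sum of (4n²+1 / p) over n mod p is the number p − 1 of points of x² = y² + 1 minus p, that is −1,
-- while the sum of (4n²+1 / p)² is p − #{y : p ∣ y² + 1} = p − c(p). The symbol takes values in {0, ±1},
-- so the local sum modulo p^a is p^(a−1) times the first sum for odd a and the second for even a.

module Submission where

open import Defs

open import Algebra.Bundles using (CommutativeMonoid)
import Algebra.Properties.CommutativeSemigroup as CommSemigroupProperties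
open import Data.Bool using (Bool; true; false; T; if_then_else_)
open import Data.Bool.ListAction using (any)
open import Data.Bool.Properties using (T-≡)
open import Data.Empty using (⊥-elim)
open import Data.Fin using (Fin; zero; suc; toℕ; fromℕ<; punchOut)
open import Data.Fin.Permutation using (permutation)
import Data.Fin.Properties as FinP
open import Data.Integer as ℤ using (ℤ; +_; -[1+_]) renaming (_^_ to _^ℤ_)
open import Data.Integer.DivMod using (_%ℕ_)
import Data.Integer.Properties as ℤP
import Data.Integer.Solver as ℤSolver
open import Data.List using ([]; _∷_; _++_; upTo; filter; length)
open import Data.List.Membership.Propositional using (find; lose)
open import Data.List.Membership.Propositional.Properties using (∈-upTo⁺; ∈-upTo⁻)
import Data.List.Properties as ListP
open import Data.List.Relation.Unary.Any.Properties using (any⁺; any⁻)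
open import Data.Nat as ℕ
  using (ℕ; zero; suc; _+_; _*_; _∸_; _^_; _%_; _/_; _≤_; _<_; z≤n; s≤s; NonZero; _≟_)
open import Data.Nat.Coprimality as Coprime using (Coprime; coprime-divisor; prime⇒coprime)
open import Data.Nat.DivMod
  using (m≡m%n+[m/n]*n; m%n<n; m<n⇒m%n≡m; m%n%n≡m%n; %-distribˡ-+; %-distribˡ-*; [m+kn]%n≡m%n; %-remove-+ʳ;
         m/n<m; m*n/n≡m)
open import Data.Nat.Divisibility
  using (_∣_; _∣?_; m%n≡0⇔n∣m; m%n≡0⇒n∣m; divides; >⇒∤; ∣-refl; ∣-trans; ∣1⇒≡1; n∣m*n; m∣m*n; ∣n⇒∣m*n)
open import Data.Nat.Divisibility.Core using (hasNonTrivialDivisor)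
open import Data.Nat.Induction using (<-wellFounded)
open import Data.Nat.Primality
  using (Prime; prime?; prime[2]; prime⇒irreducible; prime⇒nonZero; prime⇒nonTrivial; _Rough_; 2-rough;
         ∤⇒rough-suc; rough∧∣⇒rough; rough∧∣⇒prime; euclidsLemma)
import Data.Nat.Properties as ℕP
import Data.Nat.Solver as ℕSolver
open import Data.Product using (_×_; _,_; proj₁; proj₂; ∃)
open import Data.Rational as ℚ using (ℚ; 0ℚ; 1ℚ; fromℚᵘ; _-_) renaming (_*_ to _*ℚ_)
import Data.Rational.Properties as ℚP
open import Data.Rational.Unnormalised as ℚᵘ using (mkℚᵘ; *≡*)
import Data.Rational.Unnormalised.Properties as ℚᵘP
open import Data.Sum using (_⊎_; inj₁; inj₂)
open import Function using (_∘_; _⇔_; mk⇔; Equivalence; it; case_of_)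
open import Function.Definitions using (Injective)
import Function.Properties.Equivalence as ⇔
open import Induction.WellFounded using (Acc; acc)
open import Relation.Binary.PropositionalEquality
open import Relation.Nullary using (¬_; Dec; yes; no)
open import Relation.Nullary.Decidable using (⌊_⌋; _⊎-dec_; _×-dec_)

open import Algebra.Properties.Semiring.Sum ℤP.+-*-semiring
  using (sum; sum-cong-≗; sum-permute; ∑-distrib-+; ∑-comm; *-distribˡ-sum; *-distribʳ-sum)
open import Algebra.Properties.AbelianGroup ℤP.+-0-abelianGroup using (∙-cancelˡ)
open CommSemigroupProperties ℤP.*-commutativeSemigroup using (x∙yz≈y∙xz)
open ≡-Reasoning

sumBelow : ℕ → (ℕ → ℤ) → ℤ
sumBelow N f = sum {N} (f ∘ toℕ)

sumBelow-cong : ∀ N {f g : ℕ → ℤ} → (∀ i → i < N → f i ≡ g i) → sumBelow N f ≡ sumBelow N g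
sumBelow-cong N f≡g = sum-cong-≗ (λ i → f≡g (toℕ i) (FinP.toℕ<n i))

sumBelow-≗ : ∀ N {f g : ℕ → ℤ} → (∀ i → f i ≡ g i) → sumBelow N f ≡ sumBelow N g
sumBelow-≗ N f≡g = sumBelow-cong N (λ i _ → f≡g i)

sumBelow-+ : ∀ A B f → sumBelow (A + B) f ≡ sumBelow A f ℤ.+ sumBelow B (λ i → f (A + i))
sumBelow-+ zero    B f = sym (ℤP.+-identityˡ _)
sumBelow-+ (suc A) B f = trans (cong (ℤ._+_ (f 0)) (sumBelow-+ A B (f ∘ suc))) (sym (ℤP.+-assoc (f 0) _ _))

sumBelow-last : ∀ N f → sumBelow (suc N) f ≡ sumBelow N f ℤ.+ f N
sumBelow-last N f = begin
  sumBelow (suc N) f                        ≡⟨ cong (λ M → sumBelow M f) (ℕP.+-comm 1 N) ⟩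
  sumBelow (N + 1) f                        ≡⟨ sumBelow-+ N 1 f ⟩
  sumBelow N f ℤ.+ (f (N + 0) ℤ.+ + 0)      ≡⟨ cong (λ x → sumBelow N f ℤ.+ x) (ℤP.+-identityʳ _) ⟩
  sumBelow N f ℤ.+ f (N + 0)                ≡⟨ cong (λ i → sumBelow N f ℤ.+ f i) (ℕP.+-identityʳ N) ⟩
  sumBelow N f ℤ.+ f N                      ∎

sumBelow-head : ∀ N .{{_ : NonZero N}} f → sumBelow N f ≡ f 0 ℤ.+ sumBelow (N ∸ 1) (f ∘ suc)
sumBelow-head (suc N) f = refl

sumBelow-distrib-+ : ∀ N f g → sumBelow N (λ i → f i ℤ.+ g i) ≡ sumBelow N f ℤ.+ sumBelow N g
sumBelow-distrib-+ N f g = ∑-distrib-+ {N} (f ∘ toℕ) (g ∘ toℕ)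

sumBelow-comm : ∀ A B (g : ℕ → ℕ → ℤ) →
  sumBelow A (λ i → sumBelow B (g i)) ≡ sumBelow B (λ j → sumBelow A (λ i → g i j))
sumBelow-comm A B g = ∑-comm {A} {B} (λ i j → g (toℕ i) (toℕ j))

*-distribˡ-sumBelow : ∀ N c f → c ℤ.* sumBelow N f ≡ sumBelow N (λ i → c ℤ.* f i)
*-distribˡ-sumBelow N c f = *-distribˡ-sum {N} c (f ∘ toℕ)

*-distribʳ-sumBelow : ∀ N c f → sumBelow N f ℤ.* c ≡ sumBelow N (λ i → f i ℤ.* c)
*-distribʳ-sumBelow N c f = *-distribʳ-sum {N} c (f ∘ toℕ)

sumBelow-const : ∀ N c → sumBelow N (λ _ → c) ≡ + N ℤ.* c
sumBelow-const zero    c = sym (ℤP.*-zeroˡ c)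
sumBelow-const (suc N) c = begin
  c ℤ.+ sumBelow N (λ _ → c)  ≡⟨ cong (ℤ._+_ c) (sumBelow-const N c) ⟩
  c ℤ.+ + N ℤ.* c             ≡⟨ sym (ℤP.suc-* (+ N) c) ⟩
  + suc N ℤ.* c               ∎

sumBelow-zero : ∀ N {f} → (∀ i → i < N → f i ≡ + 0) → sumBelow N f ≡ + 0
sumBelow-zero N f≡0 = trans (sumBelow-cong N f≡0) (trans (sumBelow-const N (+ 0)) (ℤP.*-zeroʳ (+ N)))

sumBelow-neg : ∀ N f → sumBelow N (λ i → ℤ.- f i) ≡ ℤ.- sumBelow N f
sumBelow-neg N f = begin
  sumBelow N (λ i → ℤ.- f i)              ≡⟨ sumBelow-≗ N (λ i → sym (ℤP.-1*i≡-i (f i))) ⟩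
  sumBelow N (λ i → -[1+ 0 ] ℤ.* f i)     ≡⟨ sym (*-distribˡ-sumBelow N -[1+ 0 ] f) ⟩
  -[1+ 0 ] ℤ.* sumBelow N f               ≡⟨ ℤP.-1*i≡-i (sumBelow N f) ⟩
  ℤ.- sumBelow N f                        ∎

sumBelow-distrib-- : ∀ N f g → sumBelow N (λ i → f i ℤ.- g i) ≡ sumBelow N f ℤ.- sumBelow N g
sumBelow-distrib-- N f g =
  trans (sumBelow-distrib-+ N f (λ i → ℤ.- g i)) (cong (ℤ._+_ (sumBelow N f)) (sumBelow-neg N g))

sumBelow-blocks : ∀ T M h → sumBelow (T * M) h ≡ sumBelow T (λ t → sumBelow M (λ i → h (t * M + i)))
sumBelow-blocks zero    M h = refl
sumBelow-blocks (suc T) M h = begin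
  sumBelow (M + T * M) h
    ≡⟨ sumBelow-+ M (T * M) h ⟩
  sumBelow M h ℤ.+ sumBelow (T * M) (λ i → h (M + i))
    ≡⟨ cong (ℤ._+_ (sumBelow M h)) (sumBelow-blocks T M (λ i → h (M + i))) ⟩
  sumBelow M h ℤ.+ sumBelow T (λ t → sumBelow M (λ i → h (M + (t * M + i))))
    ≡⟨ cong (ℤ._+_ (sumBelow M h)) (sumBelow-≗ T (λ t → sumBelow-≗ M (λ i → cong h (sym (ℕP.+-assoc M (t * M) i))))) ⟩
  sumBelow (suc T) (λ t → sumBelow M (λ i → h (t * M + i)))  ∎

indicator : {A : Set} → Dec A → ℤ
indicator (yes _) = + 1
indicator (no _)  = + 0

indicator-cong : {A B : Set} (a? : Dec A) (b? : Dec B) → A ⇔ B → indicator a? ≡ indicator b?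
indicator-cong (yes _) (yes _) _   = refl
indicator-cong (no _)  (no _)  _   = refl
indicator-cong (yes a) (no ¬b) a⇔b = ⊥-elim (¬b (Equivalence.to a⇔b a))
indicator-cong (no ¬a) (yes b) a⇔b = ⊥-elim (¬a (Equivalence.from a⇔b b))

indicator-⊎ : {A B : Set} (a? : Dec A) (b? : Dec B) → ¬ (A × B) →
  indicator (a? ⊎-dec b?) ≡ indicator a? ℤ.+ indicator b?
indicator-⊎ (yes a) (yes b) ¬a×b = ⊥-elim (¬a×b (a , b))
indicator-⊎ (yes _) (no _)  _    = refl
indicator-⊎ (no _)  (yes _) _    = refl
indicator-⊎ (no _)  (no _)  _    = refl

indicator-yes : {A : Set} (a? : Dec A) → A → indicator a? ≡ + 1
indicator-yes (yes _) _ = refl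
indicator-yes (no ¬a) a = ⊥-elim (¬a a)

indicator-no : {A : Set} (a? : Dec A) → ¬ A → indicator a? ≡ + 0
indicator-no (yes a) ¬a = ⊥-elim (¬a a)
indicator-no (no _)  _  = refl

sumBelow-indicator-≡ : ∀ N c → c < N → sumBelow N (λ i → indicator (i ≟ c)) ≡ + 1
sumBelow-indicator-≡ (suc N) c c<1+N with ℕP.m≤n⇒m<n∨m≡n (ℕ.s≤s⁻¹ c<1+N)
... | inj₁ c<N = begin
  sumBelow (suc N) (λ i → indicator (i ≟ c))                    ≡⟨ sumBelow-last N (λ i → indicator (i ≟ c)) ⟩
  sumBelow N (λ i → indicator (i ≟ c)) ℤ.+ indicator (N ≟ c)
    ≡⟨ cong₂ ℤ._+_ (sumBelow-indicator-≡ N c c<N) (indicator-no (N ≟ c) (λ N≡c → ℕP.<-irrefl (sym N≡c) c<N)) ⟩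
  + 1                                                            ∎
... | inj₂ refl = begin
  sumBelow (suc N) (λ i → indicator (i ≟ N))                    ≡⟨ sumBelow-last N (λ i → indicator (i ≟ N)) ⟩
  sumBelow N (λ i → indicator (i ≟ N)) ℤ.+ indicator (N ≟ N)
    ≡⟨ cong₂ ℤ._+_ (sumBelow-zero N (λ i i<N → indicator-no (i ≟ N) (λ i≡N → ℕP.<-irrefl i≡N i<N)))
                   (indicator-yes (N ≟ N) refl) ⟩
  + 1                                                            ∎

injective⇒surjective : ∀ {N} (σ : Fin N → Fin N) → Injective _≡_ _≡_ σ → ∀ r → ∃ λ t → σ t ≡ r
injective⇒surjective {suc N} σ σ-inj r with FinP.any? (λ t → σ t FinP.≟ r)
... | yes hit = hit
... | no miss = ⊥-elim (ℕP.<-irrefl refl (FinP.injective⇒≤ τ-inj))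
  where
  τ : Fin (suc N) → Fin N
  τ t = punchOut {i = r} {j = σ t} (λ r≡σt → miss (t , sym r≡σt))
  τ-inj : Injective _≡_ _≡_ τ
  τ-inj {s} {t} τs≡τt =
    σ-inj (FinP.punchOut-injective (λ e → miss (s , sym e)) (λ e → miss (t , sym e)) τs≡τt)

sumBelow-reindex : ∀ N (σ : ℕ → ℕ) → (∀ i → i < N → σ i < N) →
  (∀ i j → i < N → j < N → σ i ≡ σ j → i ≡ j) → ∀ f → sumBelow N (f ∘ σ) ≡ sumBelow N f
sumBelow-reindex N σ σ-range σ-inj f = begin
  sum {N} (f ∘ σ ∘ toℕ)      ≡⟨ sum-cong-≗ (λ i → cong f (sym (toℕ-σ′ i))) ⟩
  sum {N} (f ∘ toℕ ∘ σ′)     ≡⟨ sym (sum-permute (f ∘ toℕ) π) ⟩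
  sum {N} (f ∘ toℕ)          ∎
  where
  σ′ : Fin N → Fin N
  σ′ i = fromℕ< (σ-range (toℕ i) (FinP.toℕ<n i))
  toℕ-σ′ : ∀ i → toℕ (σ′ i) ≡ σ (toℕ i)
  toℕ-σ′ i = FinP.toℕ-fromℕ< _
  σ′-inj : Injective _≡_ _≡_ σ′
  σ′-inj {i} {j} σ′i≡σ′j = FinP.toℕ-injective (σ-inj (toℕ i) (toℕ j) (FinP.toℕ<n i) (FinP.toℕ<n j)
    (trans (sym (toℕ-σ′ i)) (trans (cong toℕ σ′i≡σ′j) (toℕ-σ′ j))))
  σ′⁻¹ : Fin N → Fin N
  σ′⁻¹ r = proj₁ (injective⇒surjective σ′ σ′-inj r)
  π = permutation σ′ σ′⁻¹ (λ r → proj₂ (injective⇒surjective σ′ σ′-inj r))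
                          (λ i → σ′-inj (proj₂ (injective⇒surjective σ′ σ′-inj (σ′ i))))

m%n≡[m+o]%n⇒n∣o : ∀ m o N .{{_ : NonZero N}} → m % N ≡ (m + o) % N → N ∣ o
m%n≡[m+o]%n⇒n∣o m o N eq = divides (q′ ∸ q) (begin
  o                                          ≡⟨ sym (ℕP.m+n∸m≡n m o) ⟩
  (m + o) ∸ m                                ≡⟨ cong₂ _∸_ (m≡m%n+[m/n]*n (m + o) N) (m≡m%n+[m/n]*n m N) ⟩
  ((m + o) % N + q′ * N) ∸ (m % N + q * N)   ≡⟨ cong (λ r → (r + q′ * N) ∸ (m % N + q * N)) (sym eq) ⟩
  (m % N + q′ * N) ∸ (m % N + q * N)         ≡⟨ ℕP.[m+n]∸[m+o]≡n∸o (m % N) (q′ * N) (q * N) ⟩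
  q′ * N ∸ q * N                             ≡⟨ sym (ℕP.*-distribʳ-∸ N q′ q) ⟩
  (q′ ∸ q) * N                               ∎)
  where
  q  = m / N
  q′ = (m + o) / N

∣∧<⇒≡0 : ∀ {N d} → N ∣ d → d < N → d ≡ 0
∣∧<⇒≡0 {d = zero}  _   _   = refl
∣∧<⇒≡0 {d = suc d} N∣d d<N = ⊥-elim (>⇒∤ d<N N∣d)

affine-injective-≤ : ∀ N .{{_ : NonZero N}} M i → Coprime M N → ∀ x y → x ≤ y → y < N →
  (M * x + i) % N ≡ (M * y + i) % N → x ≡ y
affine-injective-≤ N M i M⊥N x y x≤y y<N eq = begin
  x           ≡⟨ sym (ℕP.+-identityʳ x) ⟩
  x + 0       ≡⟨ cong (_+_ x) (sym d≡0) ⟩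
  x + d       ≡⟨ ℕP.m+[n∸m]≡n x≤y ⟩
  y           ∎
  where
  open ℕSolver.+-*-Solver
  d = y ∸ x
  My+i : M * y + i ≡ (M * x + i) + M * d
  My+i = trans (cong (λ z → M * z + i) (sym (ℕP.m+[n∸m]≡n x≤y)))
    (solve 4 (λ M x d i → M :* (x :+ d) :+ i := (M :* x :+ i) :+ M :* d) refl M x d i)
  N∣d : N ∣ d
  N∣d = coprime-divisor (Coprime.sym M⊥N)
          (m%n≡[m+o]%n⇒n∣o (M * x + i) (M * d) N (trans eq (cong (_% N) My+i)))
  d≡0 : d ≡ 0
  d≡0 = ∣∧<⇒≡0 N∣d (ℕP.≤-<-trans (ℕP.m∸n≤m y x) y<N)

affine-injective : ∀ N .{{_ : NonZero N}} M i → Coprime M N → ∀ x y → x < N → y < N →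
  (M * x + i) % N ≡ (M * y + i) % N → x ≡ y
affine-injective N M i M⊥N x y x<N y<N eq with ℕP.≤-total x y
... | inj₁ x≤y = affine-injective-≤ N M i M⊥N x y x≤y y<N eq
... | inj₂ y≤x = sym (affine-injective-≤ N M i M⊥N y x y≤x x<N (sym eq))

sumBelow-affine : ∀ N .{{_ : NonZero N}} M i → Coprime M N → ∀ f →
  sumBelow N (λ t → f ((M * t + i) % N)) ≡ sumBelow N f
sumBelow-affine N M i M⊥N =
  sumBelow-reindex N (λ t → (M * t + i) % N) (λ t _ → m%n<n (M * t + i) N) (affine-injective N M i M⊥N)

-- Periodic functions and the Chinese remainder theorem

Periodic : ℕ → (ℕ → ℤ) → Set
Periodic P f = ∀ n → f (P + n) ≡ f n

periodic-shift : ∀ {P f} → Periodic P f → ∀ t n → f (t * P + n) ≡ f n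
periodic-shift         f-per zero    n = refl
periodic-shift {P} {f} f-per (suc t) n =
  trans (cong f (ℕP.+-assoc P (t * P) n)) (trans (f-per (t * P + n)) (periodic-shift f-per t n))

periodic-*ʳ : ∀ {P f} → Periodic P f → ∀ t → Periodic (P * t) f
periodic-*ʳ {P} {f} f-per t n = trans (cong (λ Q → f (Q + n)) (ℕP.*-comm P t)) (periodic-shift f-per t n)

periodic-% : ∀ {N f} .{{_ : NonZero N}} → Periodic N f → ∀ n → f n ≡ f (n % N)
periodic-% {N} {f} f-per n = begin
  f n                       ≡⟨ cong f (m≡m%n+[m/n]*n n N) ⟩
  f (n % N + n / N * N)     ≡⟨ cong f (ℕP.+-comm (n % N) _) ⟩
  f (n / N * N + n % N)     ≡⟨ periodic-shift f-per (n / N) (n % N) ⟩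
  f (n % N)                 ∎

periodic-* : ∀ {P Q f g} → Periodic P f → Periodic Q g → Periodic (P * Q) (λ n → f n ℤ.* g n)
periodic-* {P} {Q} f-per g-per n =
  cong₂ ℤ._*_ (periodic-*ʳ f-per Q n) (periodic-shift g-per P n)

sumBelow-periodic : ∀ {M f} → Periodic M f → ∀ T → sumBelow (T * M) f ≡ + T ℤ.* sumBelow M f
sumBelow-periodic {M} {f} f-per T = begin
  sumBelow (T * M) f                                         ≡⟨ sumBelow-blocks T M f ⟩
  sumBelow T (λ t → sumBelow M (λ i → f (t * M + i)))        ≡⟨ sumBelow-≗ T (λ t → sumBelow-≗ M (periodic-shift f-per t)) ⟩
  sumBelow T (λ _ → sumBelow M f)                            ≡⟨ sumBelow-const T (sumBelow M f) ⟩
  + T ℤ.* sumBelow M f                                       ∎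

sumFrom1≡sumBelow : ∀ N f → Periodic N f → sumFrom1 N f ≡ sumBelow N f
sumFrom1≡sumBelow N f f-per = trans (sumFrom1-shift N) (∙-cancelˡ (f 0) _ _ (begin
  f 0 ℤ.+ sumBelow N (f ∘ suc)      ≡⟨ sumBelow-last N f ⟩
  sumBelow N f ℤ.+ f N              ≡⟨ cong (λ n → sumBelow N f ℤ.+ f n) (sym (ℕP.+-identityʳ N)) ⟩
  sumBelow N f ℤ.+ f (N + 0)        ≡⟨ cong (ℤ._+_ (sumBelow N f)) (f-per 0) ⟩
  sumBelow N f ℤ.+ f 0              ≡⟨ ℤP.+-comm (sumBelow N f) (f 0) ⟩
  f 0 ℤ.+ sumBelow N f              ∎))
  where
  sumFrom1-shift : ∀ N → sumFrom1 N f ≡ sumBelow N (f ∘ suc)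
  sumFrom1-shift zero    = refl
  sumFrom1-shift (suc N) = trans (cong (ℤ._+ f (suc N)) (sumFrom1-shift N)) (sym (sumBelow-last N (f ∘ suc)))

-- Block t, position i of [0, N M) is n = t M + i; for fixed i, t ↦ (M t + i) mod N permutes [0, N).
sumBelow-crt : ∀ N M .{{_ : NonZero N}} → Coprime M N → ∀ F G → Periodic M F → Periodic N G →
  sumBelow (N * M) (λ n → F n ℤ.* G n) ≡ sumBelow M F ℤ.* sumBelow N G
sumBelow-crt N M M⊥N F G F-per G-per = begin
  sumBelow (N * M) (λ n → F n ℤ.* G n)
    ≡⟨ sumBelow-blocks N M (λ n → F n ℤ.* G n) ⟩
  sumBelow N (λ t → sumBelow M (λ i → F (t * M + i) ℤ.* G (t * M + i)))
    ≡⟨ sumBelow-≗ N (λ t → sumBelow-≗ M (λ i → cong₂ ℤ._*_ (periodic-shift F-per t i) (G-block t i))) ⟩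
  sumBelow N (λ t → sumBelow M (λ i → F i ℤ.* G ((M * t + i) % N)))
    ≡⟨ sumBelow-comm N M (λ t i → F i ℤ.* G ((M * t + i) % N)) ⟩
  sumBelow M (λ i → sumBelow N (λ t → F i ℤ.* G ((M * t + i) % N)))
    ≡⟨ sumBelow-≗ M (λ i → sym (*-distribˡ-sumBelow N (F i) (λ t → G ((M * t + i) % N)))) ⟩
  sumBelow M (λ i → F i ℤ.* sumBelow N (λ t → G ((M * t + i) % N)))
    ≡⟨ sumBelow-≗ M (λ i → cong (ℤ._*_ (F i)) (sumBelow-affine N M i M⊥N G)) ⟩
  sumBelow M (λ i → F i ℤ.* sumBelow N G)
    ≡⟨ sym (*-distribʳ-sumBelow M (sumBelow N G) F) ⟩
  sumBelow M F ℤ.* sumBelow N G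
    ∎
  where
  G-block : ∀ t i → G (t * M + i) ≡ G ((M * t + i) % N)
  G-block t i = trans (periodic-% G-per (t * M + i)) (cong (λ x → G ((x + i) % N)) (ℕP.*-comm t M))

prodℤ : (k : ℕ) → (Fin k → ℤ) → ℤ
prodℤ zero    f = + 1
prodℤ (suc k) f = f zero ℤ.* prodℤ k (f ∘ suc)

periodic-prod : ∀ k (P : Fin k → ℕ) (χ : Fin k → ℕ → ℤ) → (∀ j → Periodic (P j) (χ j)) →
  Periodic (prodℕ k P) (λ n → prodℤ k (λ j → χ j n))
periodic-prod zero    P χ χ-per n = refl
periodic-prod (suc k) P χ χ-per =
  periodic-* (χ-per zero) (periodic-prod k (P ∘ suc) (χ ∘ suc) (χ-per ∘ suc))

coprime-*ʳ : ∀ {a b c} → Coprime a b → Coprime a c → Coprime a (b * c)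
coprime-*ʳ a⊥b a⊥c (d∣a , d∣bc) = a⊥c (d∣a , coprime-divisor d⊥b d∣bc)
  where
  d⊥b : Coprime _ _
  d⊥b (e∣d , e∣b) = a⊥b (∣-trans e∣d d∣a , e∣b)

coprime-1ʳ : ∀ a → Coprime a 1
coprime-1ʳ a (_ , d∣1) = ∣1⇒≡1 d∣1

coprime-prodʳ : ∀ {a} k (Q : Fin k → ℕ) → (∀ j → Coprime a (Q j)) → Coprime a (prodℕ k Q)
coprime-prodʳ zero    Q a⊥Q = coprime-1ʳ _
coprime-prodʳ (suc k) Q a⊥Q = coprime-*ʳ (a⊥Q zero) (coprime-prodʳ k (Q ∘ suc) (a⊥Q ∘ suc))

coprime-^ʳ : ∀ {a b} → Coprime a b → ∀ e → Coprime a (b ^ e)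
coprime-^ʳ a⊥b zero    = coprime-1ʳ _
coprime-^ʳ a⊥b (suc e) = coprime-*ʳ a⊥b (coprime-^ʳ a⊥b e)

coprime-^ : ∀ {a b} → Coprime a b → ∀ d e → Coprime (a ^ d) (b ^ e)
coprime-^ a⊥b d e = Coprime.sym (coprime-^ʳ (Coprime.sym (coprime-^ʳ a⊥b e)) d)

distinct-primes-coprime : ∀ {P Q} → Prime P → Prime Q → P ≢ Q → Coprime P Q
distinct-primes-coprime P-prime Q-prime P≢Q {d} (d∣P , d∣Q) with prime⇒irreducible P-prime d∣P
... | inj₁ d≡1 = d≡1
... | inj₂ refl with prime⇒irreducible Q-prime d∣Q
...   | inj₁ P≡1 = P≡1
...   | inj₂ P≡Q = ⊥-elim (P≢Q P≡Q)

sumBelow-crt-prod : ∀ k (P : Fin k → ℕ) (χ : Fin k → ℕ → ℤ) → (∀ j → NonZero (P j)) →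
  (∀ i j → i ≢ j → Coprime (P i) (P j)) → (∀ j → Periodic (P j) (χ j)) →
  sumBelow (prodℕ k P) (λ n → prodℤ k (λ j → χ j n)) ≡ prodℤ k (λ j → sumBelow (P j) (χ j))
sumBelow-crt-prod zero    P χ P≢0 P-coprime χ-per = refl
sumBelow-crt-prod (suc k) P χ P≢0 P-coprime χ-per = begin
  sumBelow (P zero * R-period) (λ n → χ zero n ℤ.* R n)
    ≡⟨ sumBelow-≗ (P zero * R-period) (λ n → ℤP.*-comm (χ zero n) (R n)) ⟩
  sumBelow (P zero * R-period) (λ n → R n ℤ.* χ zero n)
    ≡⟨ sumBelow-crt (P zero) R-period {{P≢0 zero}} R⊥P₀ R (χ zero) R-per (χ-per zero) ⟩
  sumBelow R-period R ℤ.* sumBelow (P zero) (χ zero)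
    ≡⟨ cong (ℤ._* sumBelow (P zero) (χ zero))
         (sumBelow-crt-prod k (P ∘ suc) (χ ∘ suc) (P≢0 ∘ suc) P-coprime′ (χ-per ∘ suc)) ⟩
  prodℤ k (λ j → sumBelow (P (suc j)) (χ (suc j))) ℤ.* sumBelow (P zero) (χ zero)
    ≡⟨ ℤP.*-comm (prodℤ k (λ j → sumBelow (P (suc j)) (χ (suc j)))) _ ⟩
  prodℤ (suc k) (λ j → sumBelow (P j) (χ j))
    ∎
  where
  R-period = prodℕ k (P ∘ suc)
  R : ℕ → ℤ
  R n = prodℤ k (λ j → χ (suc j) n)
  R-per : Periodic R-period R
  R-per = periodic-prod k (P ∘ suc) (χ ∘ suc) (χ-per ∘ suc)
  R⊥P₀ : Coprime R-period (P zero)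
  R⊥P₀ = Coprime.sym (coprime-prodʳ k (P ∘ suc) (λ j → P-coprime zero (suc j) (λ ())))
  P-coprime′ : ∀ i j → i ≢ j → Coprime (P (suc i)) (P (suc j))
  P-coprime′ i j i≢j = P-coprime (suc i) (suc j) (i≢j ∘ FinP.suc-injective)

-- Multiplicativity of the Kronecker symbol

prodℕ-nonZero : ∀ k (f : Fin k → ℕ) → (∀ j → NonZero (f j)) → NonZero (prodℕ k f)
prodℕ-nonZero zero    f f≢0 = _
prodℕ-nonZero (suc k) f f≢0 = ℕP.m*n≢0 (f zero) _ {{f≢0 zero}} {{prodℕ-nonZero k (f ∘ suc) (f≢0 ∘ suc)}}

LeastDivisor : ℕ → ℕ → Set
LeastDivisor m s = 1 < s × s ∣ m × s Rough m

rough-≤ : ∀ {s m r} → s Rough m → 1 < r → r ∣ m → s ≤ r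
rough-≤ s-rough 1<r r∣m = ℕP.≮⇒≥ (λ r<s → s-rough (hasNonTrivialDivisor {{ℕ.n>1⇒nonTrivial 1<r}} r<s r∣m))

leastDivisor-unique : ∀ {m r s} → LeastDivisor m r → LeastDivisor m s → r ≡ s
leastDivisor-unique (1<r , r∣m , r-rough) (1<s , s∣m , s-rough) =
  ℕP.≤-antisym (rough-≤ r-rough 1<s s∣m) (rough-≤ s-rough 1<r r∣m)

leastDivisor-prime : ∀ {m s} → LeastDivisor m s → Prime s
leastDivisor-prime (1<s , s∣m , s-rough) = rough∧∣⇒prime {{ℕ.n>1⇒nonTrivial 1<s}} (rough∧∣⇒rough s-rough s∣m) ∣-refl

leastDivisor-∣ : ∀ {m n s} → LeastDivisor m s → s ∣ n → n ∣ m → LeastDivisor n s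
leastDivisor-∣ (1<s , _ , s-rough) s∣n n∣m = 1<s , s∣n , rough∧∣⇒rough s-rough n∣m

minDivFrom-least : ∀ fuel d m → 1 < d → d Rough m → 1 < m → m < d + fuel → LeastDivisor m (minDivFrom fuel d m)
minDivFrom-least zero d m 1<d d-rough 1<m m<d+0 =
  ⊥-elim (d-rough (hasNonTrivialDivisor {{ℕ.n>1⇒nonTrivial 1<m}} (subst (m <_) (ℕP.+-identityʳ d) m<d+0) ∣-refl))
minDivFrom-least (suc fuel) d m 1<d d-rough 1<m m<d+1+fuel with d ∣? m
... | yes d∣m = 1<d , d∣m , d-rough
... | no  d∤m = minDivFrom-least fuel (suc d) m (ℕP.m<n⇒m<1+n 1<d) (∤⇒rough-suc d∤m d-rough) 1<m
                  (subst (m <_) (ℕP.+-suc d fuel) m<d+1+fuel)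

spf-least : ∀ m → 1 < m → LeastDivisor m (spf m)
spf-least m 1<m = minDivFrom-least m 2 m ℕP.≤-refl 2-rough 1<m (ℕP.m<n+m m (s≤s z≤n))

divBy-< : ∀ m d → 1 < d → 0 < m → divBy m d < m
divBy-< (suc m) (suc d) 1<d _ = m/n<m (suc m) (suc d) 1<d

divBy-/ : ∀ m d .{{_ : NonZero d}} → divBy m d ≡ m / d
divBy-/ m (suc d) = refl

kronF-fuel : ∀ f₁ f₂ a n → n ≤ f₁ → n ≤ f₂ → kronF f₁ a n ≡ kronF f₂ a n
kronF-fuel zero      zero      a n             _          _          = refl
kronF-fuel zero      (suc f₂)  a zero          _          _          = refl
kronF-fuel (suc f₁)  zero      a zero          _          _          = refl
kronF-fuel (suc f₁)  (suc f₂)  a zero          _          _          = refl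
kronF-fuel (suc f₁)  (suc f₂)  a (suc zero)    _          _          = refl
kronF-fuel (suc f₁)  (suc f₂)  a (suc (suc m)) (s≤s m<f₁) (s≤s m<f₂) =
  cong (ℤ._*_ (symP a s)) (kronF-fuel f₁ f₂ a (divBy N s) (ℕ.s≤s⁻¹ (ℕP.<-≤-trans N/s<N (s≤s m<f₁)))
                                                         (ℕ.s≤s⁻¹ (ℕP.<-≤-trans N/s<N (s≤s m<f₂))))
  where
  N = suc (suc m)
  s = spf N
  N/s<N : divBy N s < N
  N/s<N = divBy-< N s (proj₁ (spf-least N (s≤s (s≤s z≤n)))) (s≤s z≤n)

kronecker-unfold : ∀ a N s → LeastDivisor N s → 1 < N → kronecker a N ≡ symP a s ℤ.* kronecker a (divBy N s)
kronecker-unfold a (suc (suc m)) s s-least 1<N with leastDivisor-unique (spf-least (suc (suc m)) 1<N) s-least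
... | refl = cong (ℤ._*_ (symP a s)) (kronF-fuel (suc m) (divBy N s) a (divBy N s)
                                         (ℕ.s≤s⁻¹ (divBy-< N s (proj₁ s-least) (s≤s z≤n))) ℕP.≤-refl)
  where N = suc (suc m)
kronecker-unfold a (suc zero) s s-least (s≤s ())

kronecker-least-* : ∀ a s n → LeastDivisor (s * n) s → .{{_ : NonZero n}} →
  kronecker a (s * n) ≡ symP a s ℤ.* kronecker a n
kronecker-least-* a s n s-least@(1<s , _ , _) = begin
  kronecker a (s * n)                            ≡⟨ kronecker-unfold a (s * n) s s-least 1<sn ⟩
  symP a s ℤ.* kronecker a (divBy (s * n) s)     ≡⟨ cong (λ m → symP a s ℤ.* kronecker a m) sn/s≡n ⟩
  symP a s ℤ.* kronecker a n                     ∎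
  where
  instance s≢0 = ℕ.nonTrivial⇒nonZero s {{ℕ.n>1⇒nonTrivial 1<s}}
  1<sn : 1 < s * n
  1<sn = ℕP.<-≤-trans 1<s (ℕP.m≤m*n s n)
  sn/s≡n : divBy (s * n) s ≡ n
  sn/s≡n = trans (divBy-/ (s * n) s) (trans (cong (_/ s) (ℕP.*-comm s n)) (m*n/n≡m n s))

-- kronecker unfolds along the least prime factor s of q n: either s = q, or s ∣ n and we recurse on n / s.
kronecker-prime-* : ∀ a {q} n → Prime q → .{{_ : NonZero n}} →
  kronecker a (q * n) ≡ symP a q ℤ.* kronecker a n
kronecker-prime-* a {q} n q-prime = go n (<-wellFounded n)
  where
  1<q : 1 < q
  1<q = ℕ.nonTrivial⇒n>1 q {{prime⇒nonTrivial q-prime}}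
  go : ∀ n .{{_ : NonZero n}} → Acc _<_ n → kronecker a (q * n) ≡ symP a q ℤ.* kronecker a n
  go n (acc rec) = by-cases (euclidsLemma q n (leastDivisor-prime s-least) (proj₁ (proj₂ s-least)))
    where
    s = spf (q * n)
    s-least : LeastDivisor (q * n) s
    s-least = spf-least (q * n) (ℕP.<-≤-trans 1<q (ℕP.m≤m*n q n))
    by-cases : s ∣ q ⊎ s ∣ n → kronecker a (q * n) ≡ symP a q ℤ.* kronecker a n
    by-cases (inj₁ s∣q) with prime⇒irreducible q-prime s∣q
    ... | inj₁ s≡1 = ⊥-elim (ℕP.<-irrefl (sym s≡1) (proj₁ s-least))
    ... | inj₂ s≡q = kronecker-least-* a q n (subst (LeastDivisor (q * n)) s≡q s-least)
    by-cases (inj₂ (divides n′ n≡n′s)) = begin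
      kronecker a (q * n)                          ≡⟨ cong (kronecker a) qn≡sqn′ ⟩
      kronecker a (s * (q * n′))                   ≡⟨ kronecker-least-* a s (q * n′) sqn′-least ⟩
      symP a s ℤ.* kronecker a (q * n′)            ≡⟨ cong (ℤ._*_ (symP a s)) (go n′ (rec n′<n)) ⟩
      symP a s ℤ.* (symP a q ℤ.* kronecker a n′)   ≡⟨ x∙yz≈y∙xz (symP a s) (symP a q) (kronecker a n′) ⟩
      symP a q ℤ.* (symP a s ℤ.* kronecker a n′)   ≡⟨ cong (ℤ._*_ (symP a q)) (sym (kronecker-least-* a s n′ sn′-least)) ⟩
      symP a q ℤ.* kronecker a (s * n′)            ≡⟨ cong (λ m → symP a q ℤ.* kronecker a m) (sym n≡sn′) ⟩
      symP a q ℤ.* kronecker a n                   ∎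
      where
      n≡sn′ : n ≡ s * n′
      n≡sn′ = trans n≡n′s (ℕP.*-comm n′ s)
      qn≡sqn′ : q * n ≡ s * (q * n′)
      qn≡sqn′ = trans (cong (q *_) n≡sn′) (solve 3 (λ q s n′ → q :* (s :* n′) := s :* (q :* n′)) refl q s n′)
        where open ℕSolver.+-*-Solver
      instance
        n′≢0 = ℕP.m*n≢0⇒n≢0 s {{subst NonZero n≡sn′ it}}
        qn′≢0 = ℕP.m*n≢0 q n′ {{prime⇒nonZero q-prime}}
      n′<n : n′ < n
      n′<n = subst (n′ <_) (sym n≡n′s) (ℕP.m<m*n n′ s (proj₁ s-least))
      sqn′-least : LeastDivisor (s * (q * n′)) s
      sqn′-least = subst (λ m → LeastDivisor m s) qn≡sqn′ s-least
      sn′-least : LeastDivisor (s * n′) s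
      sn′-least = leastDivisor-∣ s-least (m∣m*n n′) (subst (_∣ q * n) n≡sn′ (n∣m*n q))

kronecker-^-* : ∀ a {q} e n → Prime q → .{{_ : NonZero n}} →
  kronecker a (q ^ e * n) ≡ symP a q ℤ.^ e ℤ.* kronecker a n
kronecker-^-* a zero n q-prime = trans (cong (kronecker a) (ℕP.*-identityˡ n)) (sym (ℤP.*-identityˡ _))
kronecker-^-* a {q} (suc e) n q-prime = begin
  kronecker a (q * q ^ e * n)                      ≡⟨ cong (kronecker a) (ℕP.*-assoc q (q ^ e) n) ⟩
  kronecker a (q * (q ^ e * n))                    ≡⟨ kronecker-prime-* a (q ^ e * n) q-prime ⟩
  symP a q ℤ.* kronecker a (q ^ e * n)             ≡⟨ cong (ℤ._*_ (symP a q)) (kronecker-^-* a e n q-prime) ⟩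
  symP a q ℤ.* (symP a q ℤ.^ e ℤ.* kronecker a n)  ≡⟨ sym (ℤP.*-assoc (symP a q) _ _) ⟩
  symP a q ℤ.^ suc e ℤ.* kronecker a n             ∎
  where instance qᵉn≢0 = ℕP.m*n≢0 (q ^ e) n {{ℕP.m^n≢0 q e {{prime⇒nonZero q-prime}}}}

kronecker-prime : ∀ a {q} → Prime q → kronecker a q ≡ symP a q
kronecker-prime a {q} q-prime = begin
  kronecker a q                    ≡⟨ cong (kronecker a) (sym (ℕP.*-identityʳ q)) ⟩
  kronecker a (q * 1)              ≡⟨ kronecker-prime-* a 1 q-prime ⟩
  symP a q ℤ.* + 1                 ≡⟨ ℤP.*-identityʳ _ ⟩
  symP a q                         ∎

prime-powers-nonZero : ∀ k (p e : Fin k → ℕ) → (∀ j → Prime (p j)) → NonZero (prodℕ k (λ j → p j ^ e j))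
prime-powers-nonZero k p e p-prime = prodℕ-nonZero k _ (λ j → ℕP.m^n≢0 (p j) (e j) {{prime⇒nonZero (p-prime j)}})

kronecker-prime-powers : ∀ a k (p e : Fin k → ℕ) → (∀ j → Prime (p j)) →
  kronecker a (prodℕ k (λ j → p j ^ e j)) ≡ prodℤ k (λ j → symP a (p j) ℤ.^ e j)
kronecker-prime-powers a zero    p e p-prime = refl
kronecker-prime-powers a (suc k) p e p-prime =
  trans (kronecker-^-* a (e zero) _ (p-prime zero) {{prime-powers-nonZero k (p ∘ suc) (e ∘ suc) (p-prime ∘ suc)}})
        (cong (ℤ._*_ (symP a (p zero) ℤ.^ e zero)) (kronecker-prime-powers a k (p ∘ suc) (e ∘ suc) (p-prime ∘ suc)))

kronecker-factorisation : ∀ a ℓ k (p e : Fin k → ℕ) → (∀ j → Prime (p j)) →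
  kronecker a (2 ^ ℓ * prodℕ k (λ j → p j ^ e j)) ≡ symP a 2 ℤ.^ ℓ ℤ.* prodℤ k (λ j → symP a (p j) ℤ.^ e j)
kronecker-factorisation a ℓ k p e p-prime =
  trans (kronecker-^-* a ℓ _ prime[2] {{prime-powers-nonZero k p e p-prime}})
        (cong (ℤ._*_ (symP a 2 ℤ.^ ℓ)) (kronecker-prime-powers a k p e p-prime))

fromℚᵘ-homo-* : ∀ x y → fromℚᵘ (x ℚᵘ.* y) ≡ fromℚᵘ x ℚ.* fromℚᵘ y
fromℚᵘ-homo-* x y = ℚP.toℚᵘ-injective (ℚᵘP.≃-trans (ℚP.toℚᵘ-fromℚᵘ (x ℚᵘ.* y))
  (ℚᵘP.≃-sym (ℚᵘP.≃-trans (ℚP.toℚᵘ-homo-* (fromℚᵘ x) (fromℚᵘ y))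
                          (ℚᵘP.*-cong (ℚP.toℚᵘ-fromℚᵘ x) (ℚP.toℚᵘ-fromℚᵘ y)))))

fromℚᵘ-homo-+ : ∀ x y → fromℚᵘ (x ℚᵘ.+ y) ≡ fromℚᵘ x ℚ.+ fromℚᵘ y
fromℚᵘ-homo-+ x y = ℚP.toℚᵘ-injective (ℚᵘP.≃-trans (ℚP.toℚᵘ-fromℚᵘ (x ℚᵘ.+ y))
  (ℚᵘP.≃-sym (ℚᵘP.≃-trans (ℚP.toℚᵘ-homo-+ (fromℚᵘ x) (fromℚᵘ y))
                          (ℚᵘP.+-cong (ℚP.toℚᵘ-fromℚᵘ x) (ℚP.toℚᵘ-fromℚᵘ y)))))

fromℚᵘ-homo‿- : ∀ x → fromℚᵘ (ℚᵘ.- x) ≡ ℚ.- fromℚᵘ x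
fromℚᵘ-homo‿- x = ℚP.toℚᵘ-injective (ℚᵘP.≃-trans (ℚP.toℚᵘ-fromℚᵘ (ℚᵘ.- x))
  (ℚᵘP.≃-sym (ℚᵘP.≃-trans (ℚP.toℚᵘ-homo‿- (fromℚᵘ x)) (ℚᵘP.-‿cong (ℚP.toℚᵘ-fromℚᵘ x)))))

toℚ-homo-* : ∀ x y → toℚ (x ℤ.* y) ≡ toℚ x ℚ.* toℚ y
toℚ-homo-* x y = fromℚᵘ-homo-* (mkℚᵘ x 0) (mkℚᵘ y 0)

toℚ-homo-- : ∀ x y → toℚ (x ℤ.- y) ≡ toℚ x ℚ.- toℚ y
toℚ-homo-- x y = begin
  toℚ (x ℤ.- y)                                  ≡⟨ ℚP.fromℚᵘ-cong x-y≃x+[-y] ⟩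
  fromℚᵘ (mkℚᵘ x 0 ℚᵘ.+ ℚᵘ.- mkℚᵘ y 0)           ≡⟨ fromℚᵘ-homo-+ (mkℚᵘ x 0) (ℚᵘ.- mkℚᵘ y 0) ⟩
  toℚ x ℚ.+ fromℚᵘ (ℚᵘ.- mkℚᵘ y 0)               ≡⟨ cong (ℚ._+_ (toℚ x)) (fromℚᵘ-homo‿- (mkℚᵘ y 0)) ⟩
  toℚ x ℚ.- toℚ y                                ∎
  where
  x-y≃x+[-y] : mkℚᵘ (x ℤ.- y) 0 ℚᵘ.≃ mkℚᵘ x 0 ℚᵘ.+ ℚᵘ.- mkℚᵘ y 0
  x-y≃x+[-y] = *≡* (cong (ℤ._* + 1) (sym (cong₂ ℤ._+_ (ℤP.*-identityʳ x) (ℤP.*-identityʳ (ℤ.- y)))))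

inv-* : ∀ x y .{{_ : NonZero x}} .{{_ : NonZero y}} → inv (x * y) ≡ inv x ℚ.* inv y
inv-* (suc x) (suc y) = fromℚᵘ-homo-* (mkℚᵘ (+ 1) x) (mkℚᵘ (+ 1) y)

inv-*-toℚ : ∀ x .{{_ : NonZero x}} → inv x ℚ.* toℚ (+ x) ≡ 1ℚ
inv-*-toℚ (suc x) = trans (sym (fromℚᵘ-homo-* (mkℚᵘ (+ 1) x) (mkℚᵘ (+ suc x) 0)))
  (ℚP.fromℚᵘ-cong (ℚᵘP.*-inverseˡ (mkℚᵘ (+ suc x) 0)))

prodℚ-distrib-* : ∀ k (f g : Fin k → ℚ) → prodℚ k (λ j → f j ℚ.* g j) ≡ prodℚ k f ℚ.* prodℚ k g
prodℚ-distrib-* zero    f g = refl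
prodℚ-distrib-* (suc k) f g = trans (cong (ℚ._*_ (f zero ℚ.* g zero)) (prodℚ-distrib-* k (f ∘ suc) (g ∘ suc)))
  (interchange (f zero) (g zero) (prodℚ k (f ∘ suc)) (prodℚ k (g ∘ suc)))
  where open CommSemigroupProperties (CommutativeMonoid.commutativeSemigroup ℚP.*-1-commutativeMonoid) using (interchange)

prodℚ-cong : ∀ k {f g : Fin k → ℚ} → (∀ j → f j ≡ g j) → prodℚ k f ≡ prodℚ k g
prodℚ-cong zero    f≡g = refl
prodℚ-cong (suc k) f≡g = cong₂ ℚ._*_ (f≡g zero) (prodℚ-cong k (f≡g ∘ suc))

toℚ-prodℤ : ∀ k (f : Fin k → ℤ) → toℚ (prodℤ k f) ≡ prodℚ k (toℚ ∘ f)
toℚ-prodℤ zero    f = refl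
toℚ-prodℤ (suc k) f = trans (toℚ-homo-* (f zero) _) (cong (ℚ._*_ (toℚ (f zero))) (toℚ-prodℤ k (f ∘ suc)))

inv-prodℕ : ∀ k (f : Fin k → ℕ) → (f≢0 : ∀ j → NonZero (f j)) → inv (prodℕ k f) ≡ prodℚ k (inv ∘ f)
inv-prodℕ zero    f f≢0 = refl
inv-prodℕ (suc k) f f≢0 = trans (inv-* (f zero) _ {{f≢0 zero}} {{prodℕ-nonZero k (f ∘ suc) (f≢0 ∘ suc)}})
  (cong (ℚ._*_ (inv (f zero))) (inv-prodℕ k (f ∘ suc) (f≢0 ∘ suc)))

-- Local sums of the symbol of 4n² + 1

quad : ℕ → ℕ
quad n = 4 * (n * n) + 1

quadSymbol : ℕ → ℕ → ℕ → ℤ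
quadSymbol q e n = symP (+ quad n) q ℤ.^ e

odd⇒≡1+[n/2]*2 : ∀ n → ¬ 2 ∣ n → n ≡ 1 + n / 2 * 2
odd⇒≡1+[n/2]*2 n 2∤n with n % 2 in n%2≡ | m%n<n n 2
... | zero          | _               = ⊥-elim (2∤n (m%n≡0⇒n∣m n 2 n%2≡))
... | suc zero      | _               = trans (m≡m%n+[m/n]*n n 2) (cong (_+ n / 2 * 2) n%2≡)
... | suc (suc _)   | s≤s (s≤s ())

-1^[t*2]≡1 : ∀ t → -[1+ 0 ] ℤ.^ (t * 2) ≡ + 1
-1^[t*2]≡1 t = begin
  -[1+ 0 ] ℤ.^ (t * 2)          ≡⟨ cong (-[1+ 0 ] ℤ.^_) (ℕP.*-comm t 2) ⟩
  -[1+ 0 ] ℤ.^ (2 * t)          ≡⟨ sym (ℤP.^-*-assoc -[1+ 0 ] 2 t) ⟩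
  (+ 1) ℤ.^ t                   ≡⟨ ℤP.^-zeroˡ t ⟩
  + 1                           ∎

^-odd : ∀ {v} → v ≡ + 0 ⊎ v ≡ + 1 ⊎ v ≡ -[1+ 0 ] → ∀ t → v ℤ.^ (1 + t * 2) ≡ v
^-odd (inj₁ refl)        t = ℤP.*-zeroˡ ((+ 0) ℤ.^ (t * 2))
^-odd (inj₂ (inj₁ refl)) t = ℤP.^-zeroˡ (1 + t * 2)
^-odd (inj₂ (inj₂ refl)) t = cong (ℤ._*_ -[1+ 0 ]) (-1^[t*2]≡1 t)

^-even : ∀ {v} → v ≡ + 0 ⊎ v ≡ + 1 ⊎ v ≡ -[1+ 0 ] → ∀ t → v ℤ.^ (2 + t * 2) ≡ v ℤ.* v
^-even (inj₁ refl)        t = ℤP.*-zeroˡ ((+ 0) ℤ.^ (1 + t * 2))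
^-even (inj₂ (inj₁ refl)) t = ℤP.^-zeroˡ (2 + t * 2)
^-even (inj₂ (inj₂ refl)) t = -1^[t*2]≡1 (suc t)

symP₂-cong : ∀ {b b′} → b % 8 ≡ b′ % 8 → symP (+ b) 2 ≡ symP (+ b′) 2
symP₂-cong b≡b′ rewrite b≡b′ = refl

quadSymbol₂-periodic : ∀ ℓ → Periodic 2 (quadSymbol 2 ℓ)
quadSymbol₂-periodic ℓ n =
  cong (ℤ._^ ℓ) (symP₂-cong {quad (2 + n)} {quad n} (trans (cong (_% 8) expand) ([m+kn]%n≡m%n (quad n) (2 + 2 * n) 8)))
  where
  open ℕSolver.+-*-Solver
  expand : quad (2 + n) ≡ quad n + (2 + 2 * n) * 8
  expand = solve 1 (λ n → con 4 :* ((con 2 :+ n) :* (con 2 :+ n)) :+ con 1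
                          := (con 4 :* (n :* n) :+ con 1) :+ (con 2 :+ con 2 :* n) :* con 8) refl n

quadSymbol₂-periodic-^ : ∀ ℓ → Periodic (2 ^ ℓ) (quadSymbol 2 ℓ)
quadSymbol₂-periodic-^ zero    n = refl
quadSymbol₂-periodic-^ (suc ℓ) = periodic-*ʳ {2} {quadSymbol 2 (suc ℓ)} (quadSymbol₂-periodic (suc ℓ)) (2 ^ ℓ)

-- Over one period the symbol is evaluated by computation: (1 / 2) = 1 and (5 / 2) = −1.
sum-quadSymbol₂ : ∀ ℓ → sumBelow (2 ^ suc ℓ) (quadSymbol 2 (suc ℓ)) ≡ + (2 ^ ℓ) ℤ.* (+ 1 ℤ.+ (-[1+ 0 ] ℤ.^ suc ℓ ℤ.+ + 0))
sum-quadSymbol₂ ℓ = begin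
  sumBelow (2 ^ suc ℓ) (quadSymbol 2 (suc ℓ))
    ≡⟨ cong (λ N → sumBelow N (quadSymbol 2 (suc ℓ))) (ℕP.*-comm 2 (2 ^ ℓ)) ⟩
  sumBelow (2 ^ ℓ * 2) (quadSymbol 2 (suc ℓ))
    ≡⟨ sumBelow-periodic {2} {quadSymbol 2 (suc ℓ)} (quadSymbol₂-periodic (suc ℓ)) (2 ^ ℓ) ⟩
  + (2 ^ ℓ) ℤ.* ((+ 1) ℤ.^ suc ℓ ℤ.+ (-[1+ 0 ] ℤ.^ suc ℓ ℤ.+ + 0))
    ≡⟨ cong (λ x → + (2 ^ ℓ) ℤ.* (x ℤ.+ (-[1+ 0 ] ℤ.^ suc ℓ ℤ.+ + 0))) (ℤP.^-zeroˡ (suc ℓ)) ⟩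
  + (2 ^ ℓ) ℤ.* (+ 1 ℤ.+ (-[1+ 0 ] ℤ.^ suc ℓ ℤ.+ + 0))
    ∎

sum-quadSymbol₂-even : ∀ ℓ → 2 ∣ ℓ → sumBelow (2 ^ ℓ) (quadSymbol 2 ℓ) ≡ + (2 ^ ℓ)
sum-quadSymbol₂-even zero    _                   = refl
sum-quadSymbol₂-even (suc ℓ) (divides t ℓ+1≡t*2) = begin
  sumBelow (2 ^ suc ℓ) (quadSymbol 2 (suc ℓ))             ≡⟨ sum-quadSymbol₂ ℓ ⟩
  + (2 ^ ℓ) ℤ.* (+ 1 ℤ.+ (-[1+ 0 ] ℤ.^ suc ℓ ℤ.+ + 0))    ≡⟨ cong (λ x → + (2 ^ ℓ) ℤ.* (+ 1 ℤ.+ (x ℤ.+ + 0)))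
                                                               (trans (cong (-[1+ 0 ] ℤ.^_) ℓ+1≡t*2) (-1^[t*2]≡1 t)) ⟩
  + (2 ^ ℓ) ℤ.* + 2                                        ≡⟨ sym (ℤP.pos-* (2 ^ ℓ) 2) ⟩
  + (2 ^ ℓ * 2)                                            ≡⟨ cong +_ (ℕP.*-comm (2 ^ ℓ) 2) ⟩
  + (2 ^ suc ℓ)                                            ∎

sum-quadSymbol₂-odd : ∀ ℓ → ¬ 2 ∣ ℓ → sumBelow (2 ^ ℓ) (quadSymbol 2 ℓ) ≡ + 0
sum-quadSymbol₂-odd zero    2∤0   = ⊥-elim (2∤0 (divides 0 refl))
sum-quadSymbol₂-odd (suc ℓ) 2∤ℓ+1 = begin
  sumBelow (2 ^ suc ℓ) (quadSymbol 2 (suc ℓ))             ≡⟨ sum-quadSymbol₂ ℓ ⟩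
  + (2 ^ ℓ) ℤ.* (+ 1 ℤ.+ (-[1+ 0 ] ℤ.^ suc ℓ ℤ.+ + 0))    ≡⟨ cong (λ x → + (2 ^ ℓ) ℤ.* (+ 1 ℤ.+ (x ℤ.+ + 0)))
                                                               (trans (cong (-[1+ 0 ] ℤ.^_) (odd⇒≡1+[n/2]*2 (suc ℓ) 2∤ℓ+1))
                                                                      (^-odd (inj₂ (inj₂ refl)) (suc ℓ / 2))) ⟩
  + (2 ^ ℓ) ℤ.* + 0                                        ≡⟨ ℤP.*-zeroʳ (+ (2 ^ ℓ)) ⟩
  + 0                                                      ∎

%ℕ≡0⇔∣∣_∣ : ∀ z {d} .{{_ : NonZero d}} → z %ℕ d ≡ 0 ⇔ d ∣ ℤ.∣ z ∣
%ℕ≡0⇔∣∣ + n ∣ {d} = m%n≡0⇔n∣m n d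
%ℕ≡0⇔∣∣ -[1+ n ] ∣ {d} = ⇔.trans negative (m%n≡0⇔n∣m (suc n) d)
  where
  negative : -[1+ n ] %ℕ d ≡ 0 ⇔ suc n % d ≡ 0
  negative with suc n % d in r≡
  ... | zero  = mk⇔ (λ _ → refl) (λ _ → refl)
  ... | suc r = mk⇔ (λ d∸r≡0 → ⊥-elim (ℕP.<⇒≱ (subst (_< d) r≡ (m%n<n (suc n) d)) (ℕP.m∸n≡0⇒m≤n d∸r≡0))) λ ()

≢⇒≡ᵇ≡false : ∀ m n → m ≢ n → (m ℕ.≡ᵇ n) ≡ false
≢⇒≡ᵇ≡false m n m≢n with m ℕ.≡ᵇ n in eq
... | false = refl
... | true  = ⊥-elim (m≢n (ℕP.≡ᵇ⇒≡ m n (Equivalence.from T-≡ eq)))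

≡ᵇ≡false⇒≢ : ∀ {m n} → (m ℕ.≡ᵇ n) ≡ false → m ≢ n
≡ᵇ≡false⇒≢ {m} {n} m≡ᵇn m≡n = subst T m≡ᵇn (ℕP.≡⇒≡ᵇ m n m≡n)

symP-unfold : ∀ a n .{{_ : NonZero n}} → n ≢ 2 →
  symP a n ≡ (if (a %ℕ n) ℕ.≡ᵇ 0 then + 0
              else if any (λ x → ((+ (x * x) ℤ.- a) %ℕ n) ℕ.≡ᵇ 0) (upTo n) then + 1
              else -[1+ 0 ])
symP-unfold a (suc n) n≢2 rewrite ≢⇒≡ᵇ≡false (suc n) 2 n≢2 = refl

module OddPrime {p : ℕ} (p-prime : Prime p) (p-odd : ¬ 2 ∣ p) where

  instance
    p≢0 : NonZero p
    p≢0 = prime⇒nonZero p-prime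

  p≢2 : p ≢ 2
  p≢2 p≡2 = p-odd (subst (2 ∣_) (sym p≡2) ∣-refl)

  2<p : 2 < p
  2<p with ℕP.m≤n⇒m<n∨m≡n (ℕ.nonTrivial⇒n>1 p {{prime⇒nonTrivial p-prime}})
  ... | inj₁ 2<p = 2<p
  ... | inj₂ 2≡p = ⊥-elim (p≢2 (sym 2≡p))

  infix 4 _≋_ _≋?_
  _≋_ : ℕ → ℕ → Set
  a ≋ b = a % p ≡ b % p

  _≋?_ : ∀ a b → Dec (a ≋ b)
  a ≋? b = a % p ≟ b % p

  0%p≡0 : 0 % p ≡ 0
  0%p≡0 = m<n⇒m%n≡m (ℕ.>-nonZero⁻¹ p)

  ≋⇔∣∸ : ∀ {u v} → v ≤ u → u ≋ v ⇔ p ∣ u ∸ v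
  ≋⇔∣∸ {u} {v} v≤u = mk⇔
    (λ u≋v → m%n≡[m+o]%n⇒n∣o v (u ∸ v) p (trans (sym u≋v) (cong (_% p) (sym v+[u∸v]≡u))))
    (λ p∣u∸v → trans (cong (_% p) (sym v+[u∸v]≡u)) (%-remove-+ʳ v p∣u∸v))
    where
    v+[u∸v]≡u : v + (u ∸ v) ≡ u
    v+[u∸v]≡u = ℕP.m+[n∸m]≡n v≤u

  ≋⇔∣∣⊖∣ : ∀ u v → u ≋ v ⇔ p ∣ ℤ.∣ u ℤ.⊖ v ∣
  ≋⇔∣∣⊖∣ u v with ℕP.≤-total v u
  ... | inj₁ v≤u = subst (λ d → u ≋ v ⇔ p ∣ d) (sym (trans (ℤP.∣m⊖n∣≡∣n⊖m∣ u v) (ℤP.∣⊖∣-≤ v≤u))) (≋⇔∣∸ v≤u)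
  ... | inj₂ u≤v = subst (λ d → u ≋ v ⇔ p ∣ d) (sym (ℤP.∣⊖∣-≤ u≤v)) (⇔.trans (mk⇔ sym sym) (≋⇔∣∸ u≤v))

  ≋-+ˡ : ∀ u {a b} → a ≋ b → u + a ≋ u + b
  ≋-+ˡ u {a} {b} a≋b = begin
    (u + a) % p               ≡⟨ %-distribˡ-+ u a p ⟩
    (u % p + a % p) % p       ≡⟨ cong (λ r → (u % p + r) % p) a≋b ⟩
    (u % p + b % p) % p       ≡⟨ sym (%-distribˡ-+ u b p) ⟩
    (u + b) % p               ∎

  ≋-+ʳ : ∀ u {a b} → a ≋ b → a + u ≋ b + u
  ≋-+ʳ u {a} {b} a≋b = subst₂ _≋_ (ℕP.+-comm u a) (ℕP.+-comm u b) (≋-+ˡ u a≋b)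

  ≋-cancel-+ˡ : ∀ u {a b} → u + a ≋ u + b → a ≋ b
  ≋-cancel-+ˡ u {a} {b} u+a≋u+b = Equivalence.from (≋⇔∣∣⊖∣ a b)
    (subst (p ∣_) (cong ℤ.∣_∣ (ℤP.+-cancelˡ-⊖ u a b)) (Equivalence.to (≋⇔∣∣⊖∣ (u + a) (u + b)) u+a≋u+b))

  ≋-cancel-+ʳ : ∀ u {a b} → a + u ≋ b + u → a ≋ b
  ≋-cancel-+ʳ u {a} {b} a+u≋b+u = ≋-cancel-+ˡ u (subst₂ _≋_ (ℕP.+-comm a u) (ℕP.+-comm b u) a+u≋b+u)

  %-square : ∀ a → (a % p) * (a % p) ≋ a * a
  %-square a = begin
    (a % p) * (a % p) % p             ≡⟨ %-distribˡ-* (a % p) (a % p) p ⟩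
    (a % p % p) * (a % p % p) % p     ≡⟨ cong (λ r → r * r % p) (m%n%n≡m%n a p) ⟩
    (a % p) * (a % p) % p             ≡⟨ sym (%-distribˡ-* a a p) ⟩
    a * a % p                         ∎

  <∧≋⇒≡ : ∀ {x y} → x < p → y < p → x ≋ y → x ≡ y
  <∧≋⇒≡ x<p y<p x≋y = trans (sym (m<n⇒m%n≡m x<p)) (trans x≋y (m<n⇒m%n≡m y<p))

  ∣∧<p+p⇒≡0∨≡p : ∀ {s} → p ∣ s → s < p + p → s ≡ 0 ⊎ s ≡ p
  ∣∧<p+p⇒≡0∨≡p (divides zero          s≡0)  _    = inj₁ s≡0
  ∣∧<p+p⇒≡0∨≡p (divides (suc zero)    s≡p+0) _   = inj₂ (trans s≡p+0 (ℕP.+-identityʳ p))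
  ∣∧<p+p⇒≡0∨≡p (divides (suc (suc k)) s≡2p+kp) s<2p =
    ⊥-elim (ℕP.<⇒≱ s<2p (subst (p + p ≤_) (sym s≡2p+kp) (ℕP.+-monoʳ-≤ p (ℕP.m≤m+n p (k * p)))))

  ∣y*y⊖x*x∣ : ∀ x y → ℤ.∣ y * y ℤ.⊖ x * x ∣ ≡ ℤ.∣ y ℤ.⊖ x ∣ * (y + x)
  ∣y*y⊖x*x∣ x y = begin
    ℤ.∣ y * y ℤ.⊖ x * x ∣                           ≡⟨ cong ℤ.∣_∣ (sym (ℤP.[+m]-[+n]≡m⊖n (y * y) (x * x))) ⟩
    ℤ.∣ + (y * y) ℤ.- + (x * x) ∣                   ≡⟨ cong ℤ.∣_∣ difference-of-squares ⟩
    ℤ.∣ (+ y ℤ.- + x) ℤ.* (+ y ℤ.+ + x) ∣           ≡⟨ ℤP.abs-* (+ y ℤ.- + x) (+ y ℤ.+ + x) ⟩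
    ℤ.∣ + y ℤ.- + x ∣ * ℤ.∣ + y ℤ.+ + x ∣           ≡⟨ cong (_* (y + x)) (cong ℤ.∣_∣ (ℤP.[+m]-[+n]≡m⊖n y x)) ⟩
    ℤ.∣ y ℤ.⊖ x ∣ * (y + x)                         ∎
    where
    open ℤSolver.+-*-Solver
    difference-of-squares : + (y * y) ℤ.- + (x * x) ≡ (+ y ℤ.- + x) ℤ.* (+ y ℤ.+ + x)
    difference-of-squares = trans (cong₂ ℤ._-_ (ℤP.pos-* y y) (ℤP.pos-* x x))
      (solve 2 (λ y x → y :* y :- x :* x := (y :- x) :* (y :+ x)) refl (+ y) (+ x))

  square-roots : ∀ {x y} → x < p → y < p → y * y ≋ x * x → y ≡ x ⊎ y + x ≡ p
  square-roots {x} {y} x<p y<p yy≋xx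
    with euclidsLemma ℤ.∣ y ℤ.⊖ x ∣ (y + x) p-prime
           (subst (p ∣_) (∣y*y⊖x*x∣ x y) (Equivalence.to (≋⇔∣∣⊖∣ (y * y) (x * x)) yy≋xx))
  ... | inj₁ p∣∣y⊖x∣ = inj₁ (<∧≋⇒≡ y<p x<p (Equivalence.from (≋⇔∣∣⊖∣ y x) p∣∣y⊖x∣))
  ... | inj₂ p∣y+x with ∣∧<p+p⇒≡0∨≡p p∣y+x (ℕP.+-mono-< y<p x<p)
  ...   | inj₂ y+x≡p = inj₂ y+x≡p
  ...   | inj₁ y+x≡0 = inj₁ (trans (ℕP.m+n≡0⇒m≡0 y y+x≡0) (sym (ℕP.m+n≡0⇒n≡0 y y+x≡0)))

  square-root-pair : ∀ {x y} → y + x ≡ p → y * y ≋ x * x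
  square-root-pair {x} {y} y+x≡p = begin
    y * y % p                 ≡⟨ sym ([m+kn]%n≡m%n (y * y) x p) ⟩
    (y * y + x * p) % p       ≡⟨ cong (λ q → (y * y + x * q) % p) (sym y+x≡p) ⟩
    (y * y + x * (y + x)) % p ≡⟨ cong (_% p) (solve 2 (λ x y → y :* y :+ x :* (y :+ x) := x :* x :+ y :* (y :+ x)) refl x y) ⟩
    (x * x + y * (y + x)) % p ≡⟨ cong (λ q → (x * x + y * q) % p) y+x≡p ⟩
    (x * x + y * p) % p       ≡⟨ [m+kn]%n≡m%n (x * x) y p ⟩
    x * x % p                 ∎
    where open ℕSolver.+-*-Solver

  rootCount : ℕ → ℕ → ℤ
  rootCount u v = sumBelow p (λ y → indicator (y * y + u ≋? v))

  rootCount-cong : ∀ u {v v′} → v ≋ v′ → rootCount u v ≡ rootCount u v′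
  rootCount-cong u {v} {v′} v≋v′ = sumBelow-≗ p (λ y →
    indicator-cong (y * y + u ≋? v) (y * y + u ≋? v′) (mk⇔ (λ e → trans e v≋v′) (λ e → trans e (sym v≋v′))))

  root-shift : ∀ {u v x} y → x * x + u ≋ v → (y * y + u ≋ v) ⇔ (y * y ≋ x * x)
  root-shift {u} y xx+u≋v =
    mk⇔ (λ yy+u≋v → ≋-cancel-+ʳ u (trans yy+u≋v (sym xx+u≋v))) (λ yy≋xx → trans (≋-+ʳ u yy≋xx) xx+u≋v)

  rootCount-two : ∀ {u v x} → x < p → x ≢ 0 → x * x + u ≋ v → rootCount u v ≡ + 2
  rootCount-two {u} {v} {x} x<p x≢0 xx+u≋v = begin
    rootCount u v
      ≡⟨ sumBelow-cong p (λ y y<p → indicator-cong (y * y + u ≋? v) (y ≟ x ⊎-dec y ≟ p ∸ x) (roots y y<p)) ⟩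
    sumBelow p (λ y → indicator (y ≟ x ⊎-dec y ≟ p ∸ x))
      ≡⟨ sumBelow-≗ p (λ y → indicator-⊎ (y ≟ x) (y ≟ p ∸ x) (λ (y≡x , y≡p∸x) → x≢p∸x (trans (sym y≡x) y≡p∸x))) ⟩
    sumBelow p (λ y → indicator (y ≟ x) ℤ.+ indicator (y ≟ p ∸ x))
      ≡⟨ sumBelow-distrib-+ p (λ y → indicator (y ≟ x)) (λ y → indicator (y ≟ p ∸ x)) ⟩
    sumBelow p (λ y → indicator (y ≟ x)) ℤ.+ sumBelow p (λ y → indicator (y ≟ p ∸ x))
      ≡⟨ cong₂ ℤ._+_ (sumBelow-indicator-≡ p x x<p) (sumBelow-indicator-≡ p (p ∸ x) p∸x<p) ⟩
    + 2
      ∎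
    where
    x≤p : x ≤ p
    x≤p = ℕP.<⇒≤ x<p
    p∸x<p : p ∸ x < p
    p∸x<p = ℕP.∸-monoʳ-< (ℕP.n≢0⇒n>0 x≢0) x≤p
    x≢p∸x : x ≢ p ∸ x
    x≢p∸x x≡p∸x = p-odd (divides x (begin
      p              ≡⟨ sym (ℕP.m∸n+n≡m x≤p) ⟩
      p ∸ x + x      ≡⟨ cong (_+ x) (sym x≡p∸x) ⟩
      x + x          ≡⟨ cong (_+_ x) (sym (ℕP.+-identityʳ x)) ⟩
      2 * x          ≡⟨ ℕP.*-comm 2 x ⟩
      x * 2          ∎))
    roots : ∀ y → y < p → (y * y + u ≋ v) ⇔ (y ≡ x ⊎ y ≡ p ∸ x)
    roots y y<p = ⇔.trans (root-shift {x = x} y xx+u≋v) (mk⇔ to from)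
      where
      to : y * y ≋ x * x → y ≡ x ⊎ y ≡ p ∸ x
      to yy≋xx with square-roots x<p y<p yy≋xx
      ... | inj₁ y≡x   = inj₁ y≡x
      ... | inj₂ y+x≡p = inj₂ (trans (sym (ℕP.m+n∸n≡m y x)) (cong (_∸ x) y+x≡p))
      from : y ≡ x ⊎ y ≡ p ∸ x → y * y ≋ x * x
      from (inj₁ refl) = refl
      from (inj₂ refl) = square-root-pair {x} {p ∸ x} (ℕP.m∸n+n≡m x≤p)

  rootCount-one : ∀ {u v} → u ≋ v → rootCount u v ≡ + 1
  rootCount-one {u} {v} u≋v = begin
    rootCount u v                              ≡⟨ sumBelow-cong p (λ y y<p → indicator-cong (y * y + u ≋? v) (y ≟ 0) (root y y<p)) ⟩
    sumBelow p (λ y → indicator (y ≟ 0))       ≡⟨ sumBelow-indicator-≡ p 0 (ℕ.>-nonZero⁻¹ p) ⟩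
    + 1                                        ∎
    where
    root : ∀ y → y < p → (y * y + u ≋ v) ⇔ (y ≡ 0)
    root y y<p = ⇔.trans (root-shift {x = 0} y u≋v) (mk⇔ to λ { refl → refl })
      where
      to : y * y ≋ 0 → y ≡ 0
      to yy≋0 with square-roots (ℕ.>-nonZero⁻¹ p) y<p yy≋0
      ... | inj₁ y≡0   = y≡0
      ... | inj₂ y+0≡p = ⊥-elim (ℕP.<-irrefl (trans (sym (ℕP.+-identityʳ y)) y+0≡p) y<p)

  rootCount-zero : ∀ {u v} → (∀ x → x < p → ¬ (x * x + u ≋ v)) → rootCount u v ≡ + 0
  rootCount-zero {u} {v} no-root = sumBelow-zero p (λ y y<p → indicator-no (y * y + u ≋? v) (no-root y y<p))

  symP-cases : ∀ a →
      (a %ℕ p ≡ 0 × symP a p ≡ + 0)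
    ⊎ (a %ℕ p ≢ 0 × (∃ λ x → x < p × (+ (x * x) ℤ.- a) %ℕ p ≡ 0) × symP a p ≡ + 1)
    ⊎ (a %ℕ p ≢ 0 × (∀ x → x < p → (+ (x * x) ℤ.- a) %ℕ p ≢ 0) × symP a p ≡ -[1+ 0 ])
  symP-cases a rewrite symP-unfold a p p≢2 with (a %ℕ p) ℕ.≡ᵇ 0 in a≡ᵇ0
  ... | true  = inj₁ (ℕP.≡ᵇ⇒≡ _ 0 (Equivalence.from T-≡ a≡ᵇ0) , refl)
  ... | false with any (λ x → ((+ (x * x) ℤ.- a) %ℕ p) ℕ.≡ᵇ 0) (upTo p) in has-root
  ...   | true  = inj₂ (inj₁ (≡ᵇ≡false⇒≢ a≡ᵇ0 , (x , ∈-upTo⁻ x∈ , ℕP.≡ᵇ⇒≡ _ 0 x-root) , refl))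
    where
    found = find (any⁻ _ (upTo p) (Equivalence.from T-≡ has-root))
    x = proj₁ found
    x∈ = proj₁ (proj₂ found)
    x-root = proj₂ (proj₂ found)
  ...   | false = inj₂ (inj₂ (≡ᵇ≡false⇒≢ a≡ᵇ0 , no-root , refl))
    where
    no-root : ∀ x → x < p → (+ (x * x) ℤ.- a) %ℕ p ≢ 0
    no-root x x<p x-root = subst T has-root (any⁺ _ (lose (∈-upTo⁺ x<p) (ℕP.≡⇒≡ᵇ _ 0 x-root)))

  symP-values : ∀ a → symP a p ≡ + 0 ⊎ symP a p ≡ + 1 ⊎ symP a p ≡ -[1+ 0 ]
  symP-values a with symP-cases a
  ... | inj₁ (_ , symP≡0)               = inj₁ symP≡0
  ... | inj₂ (inj₁ (_ , _ , symP≡1))    = inj₂ (inj₁ symP≡1)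
  ... | inj₂ (inj₂ (_ , _ , symP≡-1))   = inj₂ (inj₂ symP≡-1)

  symP-square : ∀ a → symP a p ℤ.* symP a p ≡ + 1 ℤ.- indicator (a %ℕ p ≟ 0)
  symP-square a with symP-cases a
  ... | inj₁ (a≡0 , symP≡0)
      rewrite symP≡0 | indicator-yes (a %ℕ p ≟ 0) a≡0 = refl
  ... | inj₂ (inj₁ (a≢0 , _ , symP≡1))
      rewrite symP≡1 | indicator-no (a %ℕ p ≟ 0) a≢0 = refl
  ... | inj₂ (inj₂ (a≢0 , _ , symP≡-1))
      rewrite symP≡-1 | indicator-no (a %ℕ p ≟ 0) a≢0 = refl

  symP-rootCount : ∀ a u v → (a %ℕ p ≡ 0 ⇔ u ≋ v) → (∀ x → (+ (x * x) ℤ.- a) %ℕ p ≡ 0 ⇔ x * x + u ≋ v) →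
    symP a p ≡ rootCount u v ℤ.- + 1
  symP-rootCount a u v zero⇔ root⇔ with symP-cases a
  ... | inj₁ (a≡0 , symP≡0) =
    trans symP≡0 (sym (cong (ℤ._- + 1) (rootCount-one (Equivalence.to zero⇔ a≡0))))
  ... | inj₂ (inj₁ (a≢0 , (x , x<p , x-root) , symP≡1)) =
    trans symP≡1 (sym (cong (ℤ._- + 1) (rootCount-two x<p x≢0 (Equivalence.to (root⇔ x) x-root))))
    where
    x≢0 : x ≢ 0
    x≢0 x≡0 = a≢0 (Equivalence.from zero⇔ (Equivalence.to (root⇔ 0)
      (subst (λ z → (+ (z * z) ℤ.- a) %ℕ p ≡ 0) x≡0 x-root)))
  ... | inj₂ (inj₂ (a≢0 , no-root , symP≡-1)) =
    trans symP≡-1 (sym (cong (ℤ._- + 1) (rootCount-zero (λ x x<p x-root → no-root x x<p (Equivalence.from (root⇔ x) x-root)))))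

  %≡0⇔≋0 : ∀ u → u % p ≡ 0 ⇔ u ≋ 0
  %≡0⇔≋0 u = mk⇔ (λ u%p≡0 → trans u%p≡0 (sym 0%p≡0)) (λ u≋0 → trans u≋0 0%p≡0)

  symP-rootCount⁺ : ∀ b → symP (+ b) p ≡ rootCount 0 b ℤ.- + 1
  symP-rootCount⁺ b = symP-rootCount (+ b) 0 b (⇔.trans (%≡0⇔≋0 b) (mk⇔ sym sym)) root⇔
    where
    root⇔ : ∀ x → (+ (x * x) ℤ.- + b) %ℕ p ≡ 0 ⇔ x * x + 0 ≋ b
    root⇔ x = ⇔.trans (%ℕ≡0⇔∣∣ + (x * x) ℤ.- + b ∣)
      (subst (λ d → p ∣ d ⇔ x * x + 0 ≋ b) (cong ℤ.∣_∣ (sym (ℤP.[+m]-[+n]≡m⊖n (x * x) b)))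
        (subst (λ n → p ∣ ℤ.∣ x * x ℤ.⊖ b ∣ ⇔ n ≋ b) (sym (ℕP.+-identityʳ (x * x))) (⇔.sym (≋⇔∣∣⊖∣ (x * x) b))))

  symP-rootCount⁻¹ : symP -[1+ 0 ] p ≡ rootCount 1 0 ℤ.- + 1
  symP-rootCount⁻¹ = symP-rootCount -[1+ 0 ] 1 0
    (⇔.trans (%ℕ≡0⇔∣∣ -[1+ 0 ] ∣) (⇔.trans (⇔.sym (m%n≡0⇔n∣m 1 p)) (%≡0⇔≋0 1)))
    (λ x → %≡0⇔≋0 (x * x + 1))

  c≡rootCount : c p ≡ rootCount 1 0
  c≡rootCount = begin
    + 1 ℤ.+ kronecker -[1+ 0 ] p          ≡⟨ cong (ℤ._+_ (+ 1)) (kronecker-prime -[1+ 0 ] p-prime) ⟩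
    + 1 ℤ.+ symP -[1+ 0 ] p               ≡⟨ cong (ℤ._+_ (+ 1)) symP-rootCount⁻¹ ⟩
    + 1 ℤ.+ (rootCount 1 0 ℤ.- + 1)       ≡⟨ solve 1 (λ r → con (+ 1) :+ (r :- con (+ 1)) := r) refl (rootCount 1 0) ⟩
    rootCount 1 0                         ∎
    where open ℤSolver.+-*-Solver

  ≋-quad : ∀ n → (2 * n + 0) % p * ((2 * n + 0) % p) + 1 ≋ quad n
  ≋-quad n = trans (≋-+ʳ 1 (%-square (2 * n + 0)))
    (cong (_% p) (solve 1 (λ n → (con 2 :* n :+ con 0) :* (con 2 :* n :+ con 0) :+ con 1 := con 4 :* (n :* n) :+ con 1) refl n))
    where open ℕSolver.+-*-Solver

  2⊥p : Coprime 2 p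
  2⊥p = Coprime.sym (prime⇒coprime p-prime 2<p)

  1⊥p : Coprime 1 p
  1⊥p = Coprime.sym (coprime-1ʳ p)

  [2*[1+u]]⊥p : ∀ u → suc u < p → Coprime (2 * suc u) p
  [2*[1+u]]⊥p u 1+u<p = Coprime.sym (coprime-*ʳ (prime⇒coprime p-prime 2<p) (prime⇒coprime p-prime 1+u<p))

  rootCount-hyperbola-row : ∀ y → rootCount 0 (y * y + 1) ≡ sumBelow p (λ t → indicator (2 * t * y + t * t ≋? 1))
  rootCount-hyperbola-row y = begin
    sumBelow p (λ x → indicator (x * x + 0 ≋? y * y + 1))
      ≡⟨ sym (sumBelow-affine p 1 y 1⊥p (λ x → indicator (x * x + 0 ≋? y * y + 1))) ⟩
    sumBelow p (λ t → indicator (x t * x t + 0 ≋? y * y + 1))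
      ≡⟨ sumBelow-≗ p (λ t → indicator-cong (x t * x t + 0 ≋? y * y + 1) (2 * t * y + t * t ≋? 1) (shifted t)) ⟩
    sumBelow p (λ t → indicator (2 * t * y + t * t ≋? 1))
      ∎
    where
    open ℕSolver.+-*-Solver
    x : ℕ → ℕ
    x t = (1 * t + y) % p
    expand : ∀ t → x t * x t + 0 ≋ y * y + (2 * t * y + t * t)
    expand t = trans (≋-+ʳ 0 (%-square (1 * t + y)))
      (cong (_% p) (solve 2 (λ t y → (con 1 :* t :+ y) :* (con 1 :* t :+ y) :+ con 0 := y :* y :+ (con 2 :* t :* y :+ t :* t)) refl t y))
    shifted : ∀ t → (x t * x t + 0 ≋ y * y + 1) ⇔ (2 * t * y + t * t ≋ 1)
    shifted t = mk⇔ (λ e → ≋-cancel-+ˡ (y * y) (trans (sym (expand t)) e))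
                    (λ e → trans (expand t) (≋-+ˡ (y * y) e))

  -- The conic x² = y² + 1 has p − 1 points: substituting x = y + t, each t ≠ 0 determines y uniquely.
  sum-rootCount-hyperbola : sumBelow p (λ y → rootCount 0 (y * y + 1)) ≡ + p ℤ.- + 1
  sum-rootCount-hyperbola = begin
    sumBelow p (λ y → rootCount 0 (y * y + 1))
      ≡⟨ sumBelow-≗ p rootCount-hyperbola-row ⟩
    sumBelow p (λ y → sumBelow p (λ t → row t y))
      ≡⟨ sumBelow-comm p p (λ y t → row t y) ⟩
    sumBelow p (λ t → sumBelow p (row t))
      ≡⟨ sumBelow-head p (λ t → sumBelow p (row t)) ⟩
    sumBelow p (row 0) ℤ.+ sumBelow (p ∸ 1) (λ u → sumBelow p (row (suc u)))
      ≡⟨ cong₂ ℤ._+_ (sumBelow-zero p (λ y _ → indicator-no (0 ≋? 1) 0≉1))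
                     (sumBelow-cong (p ∸ 1) (λ u u<p-1 → row-solvable u (ℕP.<-≤-trans (s≤s u<p-1) (ℕP.≤-reflexive p-1+1)))) ⟩
    + 0 ℤ.+ sumBelow (p ∸ 1) (λ _ → + 1)
      ≡⟨ trans (ℤP.+-identityˡ _) (trans (sumBelow-const (p ∸ 1) (+ 1)) (ℤP.*-identityʳ _)) ⟩
    + (p ∸ 1)
      ≡⟨ sym (trans (ℤP.m-n≡m⊖n p 1) (ℤP.⊖-≥ (ℕ.>-nonZero⁻¹ p))) ⟩
    + p ℤ.- + 1
      ∎
    where
    row : ℕ → ℕ → ℤ
    row t y = indicator (2 * t * y + t * t ≋? 1)
    p-1+1 : suc (p ∸ 1) ≡ p
    p-1+1 = ℕP.suc-pred p
    0≉1 : ¬ (0 ≋ 1)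
    0≉1 0≋1 = ℕP.0≢1+n (<∧≋⇒≡ (ℕ.>-nonZero⁻¹ p) (ℕP.<⇒≤ 2<p) 0≋1)
    row-solvable : ∀ u → suc u < p → sumBelow p (row (suc u)) ≡ + 1
    row-solvable u 1+u<p = trans (sumBelow-affine p (2 * suc u) (suc u * suc u) ([2*[1+u]]⊥p u 1+u<p) (λ w → indicator (w ≟ 1 % p)))
                                 (sumBelow-indicator-≡ p (1 % p) (m%n<n 1 p))

  symP-≋ : ∀ {b b′} → b ≋ b′ → symP (+ b) p ≡ symP (+ b′) p
  symP-≋ {b} {b′} b≋b′ = begin
    symP (+ b) p                 ≡⟨ symP-rootCount⁺ b ⟩
    rootCount 0 b ℤ.- + 1        ≡⟨ cong (ℤ._- + 1) (rootCount-cong 0 b≋b′) ⟩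
    rootCount 0 b′ ℤ.- + 1       ≡⟨ sym (symP-rootCount⁺ b′) ⟩
    symP (+ b′) p                ∎

  symP-quad-periodic : Periodic p (λ n → symP (+ quad n) p)
  symP-quad-periodic n = symP-≋ (trans (cong (_% p) expand) ([m+kn]%n≡m%n (quad n) (4 * p + 8 * n) p))
    where
    open ℕSolver.+-*-Solver
    expand : quad (p + n) ≡ quad n + (4 * p + 8 * n) * p
    expand = solve 2 (λ p n → con 4 :* ((p :+ n) :* (p :+ n)) :+ con 1
                             := (con 4 :* (n :* n) :+ con 1) :+ (con 4 :* p :+ con 8 :* n) :* p) refl p n

  sum-symP-quad : sumBelow p (λ n → symP (+ quad n) p) ≡ -[1+ 0 ]
  sum-symP-quad = begin
    sumBelow p (λ n → symP (+ quad n) p)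
      ≡⟨ sumBelow-≗ p (λ n → trans (symP-rootCount⁺ (quad n)) (cong (ℤ._- + 1) (rootCount-cong 0 (sym (≋-quad n))))) ⟩
    sumBelow p (λ n → H ((2 * n + 0) % p) ℤ.- + 1)
      ≡⟨ sumBelow-distrib-- p (λ n → H ((2 * n + 0) % p)) (λ _ → + 1) ⟩
    sumBelow p (λ n → H ((2 * n + 0) % p)) ℤ.- sumBelow p (λ _ → + 1)
      ≡⟨ cong₂ ℤ._-_ (sumBelow-affine p 2 0 2⊥p H) (sumBelow-const p (+ 1)) ⟩
    sumBelow p H ℤ.- + p ℤ.* + 1
      ≡⟨ cong₂ ℤ._-_ sum-rootCount-hyperbola (ℤP.*-identityʳ (+ p)) ⟩
    (+ p ℤ.- + 1) ℤ.- + p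
      ≡⟨ solve 1 (λ P → (P :- con (+ 1)) :- P := con -[1+ 0 ]) refl (+ p) ⟩
    -[1+ 0 ]
      ∎
    where
    open ℤSolver.+-*-Solver
    H : ℕ → ℤ
    H y = rootCount 0 (y * y + 1)

  sum-symP²-quad : sumBelow p (λ n → symP (+ quad n) p ℤ.* symP (+ quad n) p) ≡ + p ℤ.- c p
  sum-symP²-quad = begin
    sumBelow p (λ n → symP (+ quad n) p ℤ.* symP (+ quad n) p)
      ≡⟨ sumBelow-≗ p (λ n → symP-square (+ quad n)) ⟩
    sumBelow p (λ n → + 1 ℤ.- indicator (quad n % p ≟ 0))
      ≡⟨ sumBelow-distrib-- p (λ _ → + 1) (λ n → indicator (quad n % p ≟ 0)) ⟩
    sumBelow p (λ _ → + 1) ℤ.- sumBelow p (λ n → indicator (quad n % p ≟ 0))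
      ≡⟨ cong₂ ℤ._-_ (trans (sumBelow-const p (+ 1)) (ℤP.*-identityʳ (+ p))) (sumBelow-≗ p divides-quad) ⟩
    + p ℤ.- sumBelow p (λ n → G ((2 * n + 0) % p))
      ≡⟨ cong (ℤ._-_ (+ p)) (sumBelow-affine p 2 0 2⊥p G) ⟩
    + p ℤ.- rootCount 1 0
      ≡⟨ cong (ℤ._-_ (+ p)) (sym c≡rootCount) ⟩
    + p ℤ.- c p
      ∎
    where
    G : ℕ → ℤ
    G y = indicator (y * y + 1 ≋? 0)
    divides-quad : ∀ n → indicator (quad n % p ≟ 0) ≡ G ((2 * n + 0) % p)
    divides-quad n = indicator-cong (quad n % p ≟ 0) (_ ≋? 0)
      (⇔.trans (%≡0⇔≋0 (quad n)) (mk⇔ (trans (≋-quad n)) (trans (sym (≋-quad n)))))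

  quadSymbol-periodic₁ : ∀ e → Periodic p (quadSymbol p e)
  quadSymbol-periodic₁ e n = cong (ℤ._^ e) (symP-quad-periodic n)

  quadSymbol-periodic : ∀ e → Periodic (p ^ e) (quadSymbol p e)
  quadSymbol-periodic zero    n = refl
  quadSymbol-periodic (suc e) = periodic-*ʳ {p} {quadSymbol p (suc e)} (quadSymbol-periodic₁ (suc e)) (p ^ e)

  sum-quadSymbol : ∀ e → sumBelow (p ^ suc e) (quadSymbol p (suc e)) ≡ + (p ^ e) ℤ.* sumBelow p (quadSymbol p (suc e))
  sum-quadSymbol e = trans (cong (λ N → sumBelow N (quadSymbol p (suc e))) (ℕP.*-comm p (p ^ e)))
    (sumBelow-periodic {p} {quadSymbol p (suc e)} (quadSymbol-periodic₁ (suc e)) (p ^ e))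

  sum-quadSymbol-odd : ∀ e → ¬ 2 ∣ e → sumBelow (p ^ e) (quadSymbol p e) ≡ + (p ^ (e ∸ 1)) ℤ.* -[1+ 0 ]
  sum-quadSymbol-odd zero    2∤0 = ⊥-elim (2∤0 (divides 0 refl))
  sum-quadSymbol-odd (suc e) 2∤e+1 = trans (sum-quadSymbol e) (cong (ℤ._*_ (+ (p ^ e))) (begin
    sumBelow p (quadSymbol p (suc e))       ≡⟨ sumBelow-≗ p (λ n → trans (cong (symP (+ quad n) p ℤ.^_) (odd⇒≡1+[n/2]*2 (suc e) 2∤e+1))
                                                                      (^-odd (symP-values (+ quad n)) (suc e / 2))) ⟩
    sumBelow p (λ n → symP (+ quad n) p)    ≡⟨ sum-symP-quad ⟩
    -[1+ 0 ]                                ∎))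

  sum-quadSymbol-even : ∀ e → 1 ≤ e → 2 ∣ e → sumBelow (p ^ e) (quadSymbol p e) ≡ + (p ^ (e ∸ 1)) ℤ.* (+ p ℤ.- c p)
  sum-quadSymbol-even (suc e) _ (divides zero ())
  sum-quadSymbol-even (suc e) _ (divides (suc t) e+1≡2+2t) = trans (sum-quadSymbol e) (cong (ℤ._*_ (+ (p ^ e))) (begin
    sumBelow p (quadSymbol p (suc e))       ≡⟨ sumBelow-≗ p (λ n → trans (cong (symP (+ quad n) p ℤ.^_) e+1≡2+2t)
                                                                      (^-even (symP-values (+ quad n)) t)) ⟩
    sumBelow p (λ n → symP (+ quad n) p ℤ.* symP (+ quad n) p)    ≡⟨ sum-symP²-quad ⟩
    + p ℤ.- c p                             ∎))

  inv-^-*-toℚ : ∀ e Y → inv (p ^ suc e) ℚ.* toℚ (+ (p ^ e) ℤ.* Y) ≡ inv p ℚ.* toℚ Y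
  inv-^-*-toℚ e Y = begin
    inv (p * p ^ e) ℚ.* toℚ (+ (p ^ e) ℤ.* Y)              ≡⟨ cong₂ ℚ._*_ (inv-* p (p ^ e)) (toℚ-homo-* (+ (p ^ e)) Y) ⟩
    (inv p ℚ.* inv (p ^ e)) ℚ.* (toℚ (+ (p ^ e)) ℚ.* toℚ Y) ≡⟨ ℚP.*-assoc (inv p) (inv (p ^ e)) _ ⟩
    inv p ℚ.* (inv (p ^ e) ℚ.* (toℚ (+ (p ^ e)) ℚ.* toℚ Y)) ≡⟨ cong (ℚ._*_ (inv p)) (sym (ℚP.*-assoc (inv (p ^ e)) _ _)) ⟩
    inv p ℚ.* ((inv (p ^ e) ℚ.* toℚ (+ (p ^ e))) ℚ.* toℚ Y) ≡⟨ cong (λ x → inv p ℚ.* (x ℚ.* toℚ Y)) (inv-*-toℚ (p ^ e)) ⟩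
    inv p ℚ.* (1ℚ ℚ.* toℚ Y)                               ≡⟨ cong (ℚ._*_ (inv p)) (ℚP.*-identityˡ (toℚ Y)) ⟩
    inv p ℚ.* toℚ Y                                        ∎
    where instance pᵉ≢0 = ℕP.m^n≢0 p e

  average-quadSymbol : ∀ e → 1 ≤ e →
    inv (p ^ e) ℚ.* toℚ (sumBelow (p ^ e) (quadSymbol p e))
      ≡ (inv (if ⌊ 2 ∣? e ⌋ then 1 else p) ℚ.* toℚ (if ⌊ 2 ∣? e ⌋ then + 1 else -[1+ 0 ]))
          ℚ.* (if ⌊ 2 ∣? e ⌋ then 1ℚ ℚ.- toℚ (c p) ℚ.* inv p else 1ℚ)
  average-quadSymbol (suc e) _ with 2 ∣? suc e
  ... | yes 2∣e+1 = begin
    inv (p ^ suc e) ℚ.* toℚ (sumBelow (p ^ suc e) (quadSymbol p (suc e)))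
      ≡⟨ cong (λ s → inv (p ^ suc e) ℚ.* toℚ s) (sum-quadSymbol-even (suc e) (s≤s z≤n) 2∣e+1) ⟩
    inv (p ^ suc e) ℚ.* toℚ (+ (p ^ e) ℤ.* (+ p ℤ.- c p))
      ≡⟨ inv-^-*-toℚ e (+ p ℤ.- c p) ⟩
    inv p ℚ.* toℚ (+ p ℤ.- c p)
      ≡⟨ cong (ℚ._*_ (inv p)) (toℚ-homo-- (+ p) (c p)) ⟩
    inv p ℚ.* (toℚ (+ p) ℚ.- toℚ (c p))
      ≡⟨ ℚP.*-distribˡ-+ (inv p) (toℚ (+ p)) (ℚ.- toℚ (c p)) ⟩
    inv p ℚ.* toℚ (+ p) ℚ.+ inv p ℚ.* (ℚ.- toℚ (c p))
      ≡⟨ cong₂ ℚ._+_ (inv-*-toℚ p) (sym (ℚP.neg-distribʳ-* (inv p) (toℚ (c p)))) ⟩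
    1ℚ ℚ.- inv p ℚ.* toℚ (c p)
      ≡⟨ cong (ℚ._-_ 1ℚ) (ℚP.*-comm (inv p) (toℚ (c p))) ⟩
    1ℚ ℚ.- toℚ (c p) ℚ.* inv p
      ≡⟨ sym (ℚP.*-identityˡ _) ⟩
    (inv 1 ℚ.* toℚ (+ 1)) ℚ.* (1ℚ ℚ.- toℚ (c p) ℚ.* inv p)
      ∎
  ... | no 2∤e+1 = begin
    inv (p ^ suc e) ℚ.* toℚ (sumBelow (p ^ suc e) (quadSymbol p (suc e)))
      ≡⟨ cong (λ s → inv (p ^ suc e) ℚ.* toℚ s) (sum-quadSymbol-odd (suc e) 2∤e+1) ⟩
    inv (p ^ suc e) ℚ.* toℚ (+ (p ^ e) ℤ.* -[1+ 0 ])
      ≡⟨ inv-^-*-toℚ e -[1+ 0 ] ⟩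
    inv p ℚ.* toℚ -[1+ 0 ]
      ≡⟨ sym (ℚP.*-identityʳ _) ⟩
    (inv p ℚ.* toℚ -[1+ 0 ]) ℚ.* 1ℚ
      ∎

count-upTo : ∀ {P : ℕ → Set} (P? : ∀ n → Dec (P n)) N →
  + length (filter P? (upTo N)) ≡ sumBelow N (λ r → indicator (P? r))
count-upTo P? zero    = refl
count-upTo P? (suc N) = begin
  + length (filter P? (upTo (suc N)))
    ≡⟨ cong (λ xs → + length (filter P? xs)) (sym (ListP.upTo-∷ʳ N)) ⟩
  + length (filter P? (upTo N ++ N ∷ []))
    ≡⟨ cong (λ xs → + length xs) (ListP.filter-++ P? (upTo N) (N ∷ [])) ⟩
  + length (filter P? (upTo N) ++ filter P? (N ∷ []))
    ≡⟨ cong +_ (ListP.length-++ (filter P? (upTo N))) ⟩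
  + (length (filter P? (upTo N)) + length (filter P? (N ∷ [])))
    ≡⟨ ℤP.pos-+ (length (filter P? (upTo N))) _ ⟩
  + length (filter P? (upTo N)) ℤ.+ + length (filter P? (N ∷ []))
    ≡⟨ cong₂ ℤ._+_ (count-upTo P? N) (length-filter-[x] N) ⟩
  sumBelow N (λ r → indicator (P? r)) ℤ.+ indicator (P? N)
    ≡⟨ sym (sumBelow-last N (λ r → indicator (P? r))) ⟩
  sumBelow (suc N) (λ r → indicator (P? r))
    ∎
  where
  length-filter-[x] : ∀ x → + length (filter P? (x ∷ [])) ≡ indicator (P? x)
  length-filter-[x] x with P? x
  ... | yes _ = refl
  ... | no  _ = refl

isPrimeDivisor? : ∀ n r → Dec (Prime r × r ∣ n)
isPrimeDivisor? n r = prime? r ×-dec r ∣? n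

+ω≡sumBelow : ∀ n → + ω n ≡ sumBelow (suc n) (λ r → indicator (isPrimeDivisor? n r))
+ω≡sumBelow n = count-upTo (isPrimeDivisor? n) (suc n)

+ω≡sumBelow-beyond : ∀ R M → .{{_ : NonZero R}} → R ≤ M →
  + ω R ≡ sumBelow (suc M) (λ r → indicator (isPrimeDivisor? R r))
+ω≡sumBelow-beyond R M R≤M = begin
  + ω R
    ≡⟨ +ω≡sumBelow R ⟩
  sumBelow (suc R) f
    ≡⟨ sym (ℤP.+-identityʳ _) ⟩
  sumBelow (suc R) f ℤ.+ + 0
    ≡⟨ cong (ℤ._+_ (sumBelow (suc R) f)) (sym (sumBelow-zero (M ∸ R) (λ i _ → indicator-no (isPrimeDivisor? R (suc R + i)) too-big))) ⟩
  sumBelow (suc R) f ℤ.+ sumBelow (M ∸ R) (λ i → f (suc R + i))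
    ≡⟨ sym (sumBelow-+ (suc R) (M ∸ R) f) ⟩
  sumBelow (suc R + (M ∸ R)) f
    ≡⟨ cong (λ N → sumBelow N f) (cong suc (ℕP.m+[n∸m]≡n R≤M)) ⟩
  sumBelow (suc M) f
    ∎
  where
  f : ℕ → ℤ
  f r = indicator (isPrimeDivisor? R r)
  too-big : ∀ {i} → ¬ (Prime (suc R + i) × suc R + i ∣ R)
  too-big {i} (_ , R+1+i∣R) = >⇒∤ (s≤s (ℕP.m≤m+n R i)) R+1+i∣R

ω-prime-* : ∀ {P} R → Prime P → .{{_ : NonZero R}} → ¬ P ∣ R → ω (P * R) ≡ suc (ω R)
ω-prime-* {P} R P-prime P∤R = ℤP.+-injective (begin
  + ω (P * R)
    ≡⟨ +ω≡sumBelow (P * R) ⟩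
  sumBelow (suc (P * R)) (λ r → indicator (isPrimeDivisor? (P * R) r))
    ≡⟨ sumBelow-≗ (suc (P * R)) split ⟩
  sumBelow (suc (P * R)) (λ r → indicator (r ≟ P) ℤ.+ indicator (isPrimeDivisor? R r))
    ≡⟨ sumBelow-distrib-+ (suc (P * R)) (λ r → indicator (r ≟ P)) (λ r → indicator (isPrimeDivisor? R r)) ⟩
  sumBelow (suc (P * R)) (λ r → indicator (r ≟ P)) ℤ.+ sumBelow (suc (P * R)) (λ r → indicator (isPrimeDivisor? R r))
    ≡⟨ cong₂ ℤ._+_ (sumBelow-indicator-≡ (suc (P * R)) P (s≤s (ℕP.m≤m*n P R))) (sym (+ω≡sumBelow-beyond R (P * R) (ℕP.m≤n*m R P))) ⟩
  + 1 ℤ.+ + ω R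
    ∎)
  where
  instance P≢0 = prime⇒nonZero P-prime
  split : ∀ r → indicator (isPrimeDivisor? (P * R) r) ≡ indicator (r ≟ P) ℤ.+ indicator (isPrimeDivisor? R r)
  split r = trans (indicator-cong (isPrimeDivisor? (P * R) r) (r ≟ P ⊎-dec isPrimeDivisor? R r) (mk⇔ to from))
                  (indicator-⊎ (r ≟ P) (isPrimeDivisor? R r) (λ { (refl , _ , P∣R) → P∤R P∣R }))
    where
    to : Prime r × r ∣ P * R → r ≡ P ⊎ Prime r × r ∣ R
    to (r-prime , r∣PR) with euclidsLemma P R r-prime r∣PR
    ... | inj₂ r∣R = inj₂ (r-prime , r∣R)
    ... | inj₁ r∣P with prime⇒irreducible P-prime r∣P
    ...   | inj₁ r≡1 = ⊥-elim (ℕ.nonTrivial⇒≢1 {{prime⇒nonTrivial r-prime}} r≡1)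
    ...   | inj₂ r≡P = inj₁ r≡P
    from : r ≡ P ⊎ Prime r × r ∣ R → Prime r × r ∣ P * R
    from (inj₁ refl)          = P-prime , m∣m*n R
    from (inj₂ (r-prime , r∣R)) = r-prime , ∣n⇒∣m*n P r∣R

if-nonZero : ∀ b {n} → NonZero n → NonZero (if b then 1 else n)
if-nonZero true  _   = _
if-nonZero false n≢0 = n≢0

prime-∤-1 : ∀ {P} → Prime P → ¬ P ∣ 1
prime-∤-1 P-prime P∣1 = ℕ.nonTrivial⇒≢1 {{prime⇒nonTrivial P-prime}} (∣1⇒≡1 P∣1)

prime-∤-prod : ∀ {P} k (f : Fin k → ℕ) → Prime P → (∀ j → ¬ P ∣ f j) → ¬ P ∣ prodℕ k f
prime-∤-prod zero    f P-prime P∤f = prime-∤-1 P-prime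
prime-∤-prod (suc k) f P-prime P∤f P∣f₀*rest with euclidsLemma (f zero) (prodℕ k (f ∘ suc)) P-prime P∣f₀*rest
... | inj₁ P∣f₀   = P∤f zero P∣f₀
... | inj₂ P∣rest = prime-∤-prod k (f ∘ suc) P-prime (P∤f ∘ suc) P∣rest

prime-∤-distinct-prime : ∀ {P Q} → Prime P → Prime Q → P ≢ Q → ¬ P ∣ Q
prime-∤-distinct-prime P-prime Q-prime P≢Q P∣Q with prime⇒irreducible Q-prime P∣Q
... | inj₁ P≡1 = prime-∤-1 P-prime (subst (_∣ 1) (sym P≡1) ∣-refl)
... | inj₂ P≡Q = P≢Q P≡Q

-1^ω-if-* : ∀ excluded {P} R → Prime P → .{{_ : NonZero R}} → ¬ P ∣ R →
  -[1+ 0 ] ℤ.^ ω ((if excluded then 1 else P) * R) ≡ (if excluded then + 1 else -[1+ 0 ]) ℤ.* -[1+ 0 ] ℤ.^ ω R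
-1^ω-if-* true  R P-prime P∤R =
  trans (cong (λ n → -[1+ 0 ] ℤ.^ ω n) (ℕP.*-identityˡ R)) (sym (ℤP.*-identityˡ _))
-1^ω-if-* false R P-prime P∤R = cong (-[1+ 0 ] ℤ.^_) (ω-prime-* R P-prime P∤R)

-1^ω-prod-distinct-primes : ∀ k (p : Fin k → ℕ) (excluded : Fin k → Bool) → (∀ j → Prime (p j)) →
  (∀ i j → p i ≡ p j → i ≡ j) →
  -[1+ 0 ] ℤ.^ ω (prodℕ k (λ j → if excluded j then 1 else p j))
    ≡ prodℤ k (λ j → if excluded j then + 1 else -[1+ 0 ])
-1^ω-prod-distinct-primes zero    p excluded p-prime p-inj = refl
-1^ω-prod-distinct-primes (suc k) p excluded p-prime p-inj =
  trans (-1^ω-if-* (excluded zero) rest (p-prime zero) {{rest≢0}} p₀∤rest)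
        (cong (ℤ._*_ (if excluded zero then + 1 else -[1+ 0 ]))
              (-1^ω-prod-distinct-primes k (p ∘ suc) (excluded ∘ suc) (p-prime ∘ suc) p-inj′))
  where
  factor : Fin k → ℕ
  factor j = if excluded (suc j) then 1 else p (suc j)
  rest = prodℕ k factor
  p-inj′ : ∀ i j → p (suc i) ≡ p (suc j) → i ≡ j
  p-inj′ i j pᵢ≡pⱼ = FinP.suc-injective (p-inj (suc i) (suc j) pᵢ≡pⱼ)
  rest≢0 = prodℕ-nonZero k factor (λ j → if-nonZero (excluded (suc j)) (prime⇒nonZero (p-prime (suc j))))
  p₀∤factor : ∀ j → ¬ p zero ∣ factor j
  p₀∤factor j with excluded (suc j)
  ... | true  = prime-∤-1 (p-prime zero)
  ... | false = prime-∤-distinct-prime (p-prime zero) (p-prime (suc j)) (λ p₀≡pⱼ → case p-inj zero (suc j) p₀≡pⱼ of λ ())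
  p₀∤rest = prime-∤-prod k factor (p-prime zero) p₀∤factor

-- The average over a period

module _ (ℓ k : ℕ) (p a : Fin k → ℕ) (p-prime : ∀ j → Prime (p j)) (p-odd : ∀ j → ¬ 2 ∣ p j)
         (p-injective : ∀ i j → p i ≡ p j → i ≡ j) (1≤a : ∀ j → 1 ≤ a j) where

  private
    M : ℕ
    M = prodℕ k (λ j → p j ^ a j)

    instance
      M≢0 : NonZero M
      M≢0 = prime-powers-nonZero k p a p-prime

    module Pⱼ (j : Fin k) = OddPrime (p-prime j) (p-odd j)

    oddPart : ℕ → ℤ
    oddPart n = prodℤ k (λ j → quadSymbol (p j) (a j) n)

    oddPart-periodic : Periodic M oddPart
    oddPart-periodic = periodic-prod k (λ j → p j ^ a j) (λ j → quadSymbol (p j) (a j)) (λ j → Pⱼ.quadSymbol-periodic j (a j))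

    localSum : Fin k → ℤ
    localSum j = sumBelow (p j ^ a j) (quadSymbol (p j) (a j))

    M⊥2^ℓ : Coprime M (2 ^ ℓ)
    M⊥2^ℓ = Coprime.sym (coprime-prodʳ k (λ j → p j ^ a j) (λ j → coprime-^ (2⊥pⱼ j) ℓ (a j)))
      where
      2⊥pⱼ : ∀ j → Coprime 2 (p j)
      2⊥pⱼ j = distinct-primes-coprime prime[2] (p-prime j) (λ 2≡pⱼ → p-odd j (subst (2 ∣_) 2≡pⱼ ∣-refl))

    kronecker-quad : ℕ → ℤ
    kronecker-quad n = kronecker (+ quad n) (2 ^ ℓ * M)

    kronecker-quad-factorisation : ∀ n → kronecker-quad n ≡ oddPart n ℤ.* quadSymbol 2 ℓ n
    kronecker-quad-factorisation n =
      trans (kronecker-factorisation (+ quad n) ℓ k p a p-prime) (ℤP.*-comm (quadSymbol 2 ℓ n) (oddPart n))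

    sum-kronecker-quad : sumFrom1 (2 ^ ℓ * M) kronecker-quad ≡ prodℤ k localSum ℤ.* sumBelow (2 ^ ℓ) (quadSymbol 2 ℓ)
    sum-kronecker-quad = begin
      sumFrom1 (2 ^ ℓ * M) kronecker-quad
        ≡⟨ sumFrom1≡sumBelow (2 ^ ℓ * M) kronecker-quad kronecker-quad-periodic ⟩
      sumBelow (2 ^ ℓ * M) kronecker-quad
        ≡⟨ sumBelow-≗ (2 ^ ℓ * M) kronecker-quad-factorisation ⟩
      sumBelow (2 ^ ℓ * M) (λ n → oddPart n ℤ.* quadSymbol 2 ℓ n)
        ≡⟨ sumBelow-crt (2 ^ ℓ) M {{ℕP.m^n≢0 2 ℓ}} M⊥2^ℓ oddPart (quadSymbol 2 ℓ) oddPart-periodic (quadSymbol₂-periodic-^ ℓ) ⟩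
      sumBelow M oddPart ℤ.* sumBelow (2 ^ ℓ) (quadSymbol 2 ℓ)
        ≡⟨ cong (ℤ._* sumBelow (2 ^ ℓ) (quadSymbol 2 ℓ)) (sumBelow-crt-prod k (λ j → p j ^ a j) (λ j → quadSymbol (p j) (a j))
             (λ j → ℕP.m^n≢0 (p j) (a j) {{prime⇒nonZero (p-prime j)}}) pᵢ⊥pⱼ (λ j → Pⱼ.quadSymbol-periodic j (a j))) ⟩
      prodℤ k localSum ℤ.* sumBelow (2 ^ ℓ) (quadSymbol 2 ℓ)
        ∎
      where
      kronecker-quad-periodic : Periodic (2 ^ ℓ * M) kronecker-quad
      kronecker-quad-periodic n = begin
        kronecker-quad (2 ^ ℓ * M + n)      ≡⟨ kronecker-quad-factorisation (2 ^ ℓ * M + n) ⟩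
        oddPart (2 ^ ℓ * M + n) ℤ.* quadSymbol 2 ℓ (2 ^ ℓ * M + n)
          ≡⟨ cong₂ ℤ._*_ (periodic-shift oddPart-periodic (2 ^ ℓ) n) (periodic-*ʳ {2 ^ ℓ} {quadSymbol 2 ℓ} (quadSymbol₂-periodic-^ ℓ) M n) ⟩
        oddPart n ℤ.* quadSymbol 2 ℓ n     ≡⟨ sym (kronecker-quad-factorisation n) ⟩
        kronecker-quad n                    ∎
      pᵢ⊥pⱼ : ∀ i j → i ≢ j → Coprime (p i ^ a i) (p j ^ a j)
      pᵢ⊥pⱼ i j i≢j = coprime-^ (distinct-primes-coprime (p-prime i) (p-prime j) (i≢j ∘ p-injective i j)) (a i) (a j)

  average-kronecker-quad-odd : ¬ 2 ∣ ℓ → inv (2 ^ ℓ * M) ℚ.* toℚ (sumFrom1 (2 ^ ℓ * M) kronecker-quad) ≡ 0ℚ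
  average-kronecker-quad-odd 2∤ℓ = begin
    inv (2 ^ ℓ * M) ℚ.* toℚ (sumFrom1 (2 ^ ℓ * M) kronecker-quad)
      ≡⟨ cong (λ s → inv (2 ^ ℓ * M) ℚ.* toℚ s) (trans sum-kronecker-quad (cong (ℤ._*_ (prodℤ k localSum)) (sum-quadSymbol₂-odd ℓ 2∤ℓ))) ⟩
    inv (2 ^ ℓ * M) ℚ.* toℚ (prodℤ k localSum ℤ.* + 0)
      ≡⟨ cong (λ s → inv (2 ^ ℓ * M) ℚ.* toℚ s) (ℤP.*-zeroʳ (prodℤ k localSum)) ⟩
    inv (2 ^ ℓ * M) ℚ.* 0ℚ
      ≡⟨ ℚP.*-zeroʳ (inv (2 ^ ℓ * M)) ⟩
    0ℚ
      ∎

  average-kronecker-quad-even : 2 ∣ ℓ →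
    let excluded j = ⌊ 2 ∣? a j ⌋
        m₀ = prodℕ k (λ j → if excluded j then 1 else p j)
    in inv (2 ^ ℓ * M) ℚ.* toℚ (sumFrom1 (2 ^ ℓ * M) kronecker-quad)
         ≡ inv m₀ ℚ.* toℚ (-[1+ 0 ] ℤ.^ ω m₀)
             ℚ.* prodℚ k (λ j → if excluded j then 1ℚ ℚ.- toℚ (c (p j)) ℚ.* inv (p j) else 1ℚ)
  average-kronecker-quad-even 2∣ℓ = begin
    inv (2 ^ ℓ * M) ℚ.* toℚ (sumFrom1 (2 ^ ℓ * M) kronecker-quad)
      ≡⟨ cong (λ s → inv (2 ^ ℓ * M) ℚ.* toℚ s) (trans sum-kronecker-quad (trans
           (cong (ℤ._*_ (prodℤ k localSum)) (sum-quadSymbol₂-even ℓ 2∣ℓ)) (ℤP.*-comm (prodℤ k localSum) _))) ⟩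
    inv (2 ^ ℓ * M) ℚ.* toℚ (+ (2 ^ ℓ) ℤ.* prodℤ k localSum)
      ≡⟨ cong₂ ℚ._*_ (inv-* (2 ^ ℓ) M {{ℕP.m^n≢0 2 ℓ}}) (toℚ-homo-* (+ (2 ^ ℓ)) (prodℤ k localSum)) ⟩
    (inv (2 ^ ℓ) ℚ.* inv M) ℚ.* (toℚ (+ (2 ^ ℓ)) ℚ.* toℚ (prodℤ k localSum))
      ≡⟨ ℚ-interchange (inv (2 ^ ℓ)) (inv M) (toℚ (+ (2 ^ ℓ))) (toℚ (prodℤ k localSum)) ⟩
    (inv (2 ^ ℓ) ℚ.* toℚ (+ (2 ^ ℓ))) ℚ.* (inv M ℚ.* toℚ (prodℤ k localSum))
      ≡⟨ trans (cong (ℚ._* (inv M ℚ.* toℚ (prodℤ k localSum))) (inv-*-toℚ (2 ^ ℓ) {{ℕP.m^n≢0 2 ℓ}})) (ℚP.*-identityˡ _) ⟩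
    inv M ℚ.* toℚ (prodℤ k localSum)
      ≡⟨ cong₂ ℚ._*_ (inv-prodℕ k (λ j → p j ^ a j) (λ j → ℕP.m^n≢0 (p j) (a j) {{prime⇒nonZero (p-prime j)}})) (toℚ-prodℤ k localSum) ⟩
    prodℚ k (λ j → inv (p j ^ a j)) ℚ.* prodℚ k (λ j → toℚ (localSum j))
      ≡⟨ sym (prodℚ-distrib-* k (λ j → inv (p j ^ a j)) (λ j → toℚ (localSum j))) ⟩
    prodℚ k (λ j → inv (p j ^ a j) ℚ.* toℚ (localSum j))
      ≡⟨ prodℚ-cong k (λ j → Pⱼ.average-quadSymbol j (a j) (1≤a j)) ⟩
    prodℚ k (λ j → (inv (e j) ℚ.* toℚ (s j)) ℚ.* r j)
      ≡⟨ prodℚ-distrib-* k (λ j → inv (e j) ℚ.* toℚ (s j)) r ⟩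
    prodℚ k (λ j → inv (e j) ℚ.* toℚ (s j)) ℚ.* prodℚ k r
      ≡⟨ cong (ℚ._* prodℚ k r) (prodℚ-distrib-* k (λ j → inv (e j)) (λ j → toℚ (s j))) ⟩
    (prodℚ k (λ j → inv (e j)) ℚ.* prodℚ k (λ j → toℚ (s j))) ℚ.* prodℚ k r
      ≡⟨ cong (ℚ._* prodℚ k r) (cong₂ ℚ._*_ (sym (inv-prodℕ k e e≢0)) (sym (toℚ-prodℤ k s))) ⟩
    (inv (prodℕ k e) ℚ.* toℚ (prodℤ k s)) ℚ.* prodℚ k r
      ≡⟨ cong (λ z → (inv (prodℕ k e) ℚ.* toℚ z) ℚ.* prodℚ k r) (sym (-1^ω-prod-distinct-primes k p excluded p-prime p-injective)) ⟩
    inv (prodℕ k e) ℚ.* toℚ (-[1+ 0 ] ℤ.^ ω (prodℕ k e)) ℚ.* prodℚ k r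
      ∎
    where
    open CommSemigroupProperties (CommutativeMonoid.commutativeSemigroup ℚP.*-1-commutativeMonoid)
      using () renaming (interchange to ℚ-interchange)
    excluded : Fin k → Bool
    excluded j = ⌊ 2 ∣? a j ⌋
    e : Fin k → ℕ
    e j = if excluded j then 1 else p j
    s : Fin k → ℤ
    s j = if excluded j then + 1 else -[1+ 0 ]
    r : Fin k → ℚ
    r j = if excluded j then 1ℚ ℚ.- toℚ (c (p j)) ℚ.* inv (p j) else 1ℚ
    e≢0 : ∀ j → NonZero (e j)
    e≢0 j = if-nonZero (excluded j) (prime⇒nonZero (p-prime j))

lemma2p3 : (m ℓ k : ℕ) (p a : Fin k → ℕ) →
  (∀ j → Prime (p j)) → (∀ j → ¬ (2 ∣ p j)) →
  (∀ i j → p i ≡ p j → i ≡ j) → (∀ j → 1 ≤ a j) →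
  m ≡ 2 ^ ℓ * prodℕ k (λ j → p j ^ a j) →
  let m₀ = prodℕ k (λ j → if ⌊ 2 ∣? a j ⌋ then 1 else p j)
      avg = inv m *ℚ toℚ (sumFrom1 m (λ n → kronecker (+ (4 * (n * n) + 1)) m))
  in (2 ∣ ℓ → avg ≡ inv m₀ *ℚ toℚ (-[1+ 0 ] ^ℤ ω m₀)
                        *ℚ prodℚ k (λ j → if ⌊ 2 ∣? a j ⌋
                                            then 1ℚ - toℚ (c (p j)) *ℚ inv (p j)
                                            else 1ℚ))
   × (¬ (2 ∣ ℓ) → avg ≡ 0ℚ)
lemma2p3 _ ℓ k p a p-prime p-odd p-injective 1≤a refl =
  average-kronecker-quad-even ℓ k p a p-prime p-odd p-injective 1≤a ,
  average-kronecker-quad-odd ℓ k p a p-prime p-odd p-injective 1≤a
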